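{- Let $v=(v_1,\dots,v_d)$ be a finite sequence of nonnegative integers with $v_1+\dots+v_d=k>0$ and $v_1+2v_2+\dots+dv_d=n$ (i.e. $v\in\pi_d(n,k)$). Let $\alpha(\ell,m)$ be a polynomial in $\ell$ and $m$ of total degree at most one (complex coefficients), and let $\tau\in\mathbb{C}$ be such that $\alpha(\ell,m)\neq0$ and $\tau-\alpha(\ell,m)\neq 0$ for all integers $0\le\ell\le k$, $\ell\le m\le n$. Then \[ \sum_{\ell=0}^{k}\sum_{m=\ell}^n \frac{\tau\binom{\alpha(\ell,m)}{k-\ell}\binom{\tau-\alpha(\ell,m)}{\ell}}{\alpha(\ell,m)\big(\tau-\alpha(\ell,m)\big)\binom{k}{\ell}}W_{m,\ell}(v) =\frac{\tau-\alpha(0,0)+\alpha(k,n)}{\alpha(k,n)\big(\tau-\alpha(0,0)\big)}\binom{\tau}{k}. \]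
   Context: For $v=(v_1,\dots,v_d)$ with nonnegative integer entries, $W_{m,\ell}(v)=\sum_{i\in\pi_d(m,\ell)}\binom{v_1}{i_1}\cdots\binom{v_d}{i_d}$, where $\pi_d(m,\ell)$ is the set of all $i=(i_1,\dots,i_d)\in\mathbb{N}_0^d$ with $i_1+\dots+i_d=\ell$ and $i_1+2i_2+\dots+di_d=m$; $W_{m,\ell}(v)=0$ if $\pi_d(m,\ell)$ is empty. Binomial coefficients $\binom{x}{j}$ are generalized ones for complex $x$. -}

module Defs where

open import Level using (Level; _⊔_) renaming (suc to lsuc)
open import Algebra.Bundles using (CommutativeRing)
open import Data.Nat using (ℕ; zero; suc; _∸_) renaming (_+_ to _+ℕ_; _*_ to _*ℕ_)
open import Data.Nat.Combinatorics using (_C_)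
open import Data.Fin using (Fin; toℕ)
open import Data.Vec using (Vec; []; _∷_; foldr)
open import Data.List using (List; []; _∷_; map; concatMap; applyUpTo; filter)
open import Data.Product using (_×_; _,_)
open import Relation.Nullary using (¬_)
open import Relation.Binary.PropositionalEquality using (_≡_)
import Data.Nat.Properties as ℕP
open import Relation.Nullary.Decidable using (_×-dec_)

vecsUpTo : (d b : ℕ) → List (Vec ℕ d)
vecsUpTo zero    b = [] ∷ []
vecsUpTo (suc d) b = concatMap (λ i → map (i ∷_) (vecsUpTo d b)) (applyUpTo (λ i → i) (suc b))

vsum : ∀ {d} → Vec ℕ d → ℕ
vsum = foldr _ _+ℕ_ 0

wsum′ : ∀ {d} → ℕ → Vec ℕ d → ℕ
wsum′ j []       = 0
wsum′ j (x ∷ xs) = j *ℕ x +ℕ wsum′ (suc j) xs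

wsum : ∀ {d} → Vec ℕ d → ℕ
wsum = wsum′ 1

-- π_d(m,ℓ) = { i ∈ ℕ₀^d | Σ i_j = ℓ , Σ j·i_j = m }, listed without repetition.
-- (Each entry of such i is ≤ ℓ, so enumerating vectors with entries ≤ ℓ is exhaustive.)
π : (d m ℓ : ℕ) → List (Vec ℕ d)
π d m ℓ = filter (λ i → (vsum i ℕP.≟ ℓ) ×-dec (wsum i ℕP.≟ m)) (vecsUpTo d ℓ)

binomProd : ∀ {d} → Vec ℕ d → Vec ℕ d → ℕ
binomProd []       []       = 1
binomProd (v ∷ vs) (i ∷ is) = (v C i) *ℕ binomProd vs is

sumℕ : List ℕ → ℕ
sumℕ = Data.List.foldr _+ℕ_ 0

W : ∀ {d} → ℕ → ℕ → Vec ℕ d → ℕ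
W {d} m ℓ v = sumℕ (map (binomProd v) (π d m ℓ))

-- the integers a, a+1, …, b  (empty if a > b)
range : ℕ → ℕ → List ℕ
range a b = applyUpTo (a +ℕ_) (suc b ∸ a)

-- Algebraic part: a field of characteristic zero (stands in for ℂ)

module _ {c ℓ : Level} (R : CommutativeRing c ℓ) where
  open CommutativeRing R

  ι : ℕ → Carrier
  ι zero    = 0#
  ι (suc n) = 1# + ι n

record Char0Field (c ℓ : Level) : Set (lsuc (c ⊔ ℓ)) where
  field
    cring : CommutativeRing c ℓ
  open CommutativeRing cring
  field
    _⁻¹       : Carrier → Carrier
    ⁻¹-inverse : ∀ x → ¬ (x ≈ 0#) → x * (x ⁻¹) ≈ 1#
    char0      : ∀ n → ¬ (ι cring (suc n) ≈ 0#)

module FieldOps {c ℓ : Level} (F : Char0Field c ℓ) where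
  open Char0Field F public
  open CommutativeRing cring public

  fromℕ : ℕ → Carrier
  fromℕ = ι cring

  _÷_ : Carrier → Carrier → Carrier
  x ÷ y = x * (y ⁻¹)

  falling : Carrier → ℕ → Carrier
  falling x zero    = 1#
  falling x (suc j) = falling x j * (x - fromℕ j)

  factorial : ℕ → ℕ
  factorial zero    = 1
  factorial (suc n) = suc n *ℕ factorial n

  binom : Carrier → ℕ → Carrier
  binom x j = falling x j ÷ fromℕ (factorial j)

  ∑ : List ℕ → (ℕ → Carrier) → Carrier
  ∑ xs f = Data.List.foldr (λ x acc → f x + acc) 0# xs

-- Let ps be the multiset of parts of v (the part j taken v_j times), so |ps| = k and Σ ps = n.
-- Choosing i_j of the v_j copies of each j shows that W_{m,ℓ}(v) counts the sub-multisets
-- S ⊆ ps with |S| = ℓ and Σ S = m, so the left-hand side is a sum over all splittings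
-- ps = S ⊎ U.  Writing α_S = α(|S|, Σ S) = a + κ_S with κ_S additive in S, and (x)_j for the
-- falling factorial, τ / (α (τ - α)) = 1/α + 1/(τ - α) turns the summand for S into
--   (1/k!) (α_S)_{|U|} (τ - α_S)_{|S|} (1/α_S + 1/(τ - α_S)).
-- Cancelling α_S against (α_S)_{|U|}, resp. τ - α_S against (τ - α_S)_{|S|}, leaves one term
-- with U = ∅, resp. S = ∅, plus an Abel-type sum, evaluated by the falling-factorial Abel identity
--   b Σ_{S ≠ ∅} (a + κ_S)_{|U|} (b - 1 - κ_S)_{|S|-1} + (a)_k = (a + b)_k
-- and its mirror image under S ↔ U.  This identity follows by induction on ps from the fact that
-- Σ_S (x + κ_S)_{|U|} (y + κ_U)_{|S|} depends only on x + y, which in turn is proved by expanding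
-- (x + δ)_{|U|} with Vandermonde's convolution and inducting on the length of ps.

module Submission where

open import Defs
open import Level using (Level)
open import Data.Nat using (ℕ; _≤_; _<_; _∸_)
open import Data.Nat.Combinatorics using (_C_)
open import Data.Vec using (Vec)
open import Relation.Nullary using (¬_)
open import Data.Product using (_×_)
open import Relation.Binary.PropositionalEquality using (_≡_)
import Relation.Binary.PropositionalEquality as ≡
open import Algebra.Bundles using (CommutativeRing)

module Combinatorics where
  open import Data.Nat using (zero; suc; _+_; _*_; _!; z≤n)
  open import Data.Nat.Properties
  open import Data.Nat.ListAction using (sum)
  open import Data.Nat.ListAction.Properties using (sum-++; sum-↭)
  open import Data.Nat.Combinatorics using (k>n⇒nCk≡0; k![n∸k]!∣n!)
  open import Data.Nat.Combinatorics.Specification using (nCk≡n!/k![n-k]!)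
  open import Data.Nat.DivMod using (m/n*n≡m)
  open import Data.List using (List; []; _∷_; _++_; length; replicate)
  open import Data.List.Properties using (length-++; length-replicate)
  open import Data.List.Relation.Unary.All using (All; []; _∷_)
  open import Data.List.Relation.Unary.All.Properties using (++⁺; replicate⁺)
  open import Data.List.Relation.Ternary.Interleaving.Propositional
    using (Interleaving; []; consˡ; consʳ; toPermutation)
  open import Data.Vec using ([]; _∷_)
  import Data.Vec as Vec
  open import Data.Vec.Relation.Binary.Pointwise.Inductive using (Pointwise; []; _∷_)
  open import Relation.Nullary using (yes; no)
  open import Data.Empty using (⊥-elim)
  open ≡ using (refl; cong; cong₂; sym; trans)

  parts : ∀ {d} → ℕ → Vec ℕ d → List ℕ
  parts j []       = []
  parts j (x ∷ xs) = replicate x j ++ parts (suc j) xs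

  length-parts : ∀ {d} j (v : Vec ℕ d) → length (parts j v) ≡ vsum v
  length-parts j []       = refl
  length-parts j (x ∷ v) =
    trans (length-++ (replicate x j)) (cong₂ _+_ (length-replicate x) (length-parts (suc j) v))

  sum-replicate : ∀ x j → sum (replicate x j) ≡ j * x
  sum-replicate zero    j = sym (*-zeroʳ j)
  sum-replicate (suc x) j = trans (cong (j +_) (sum-replicate x j)) (sym (*-suc j x))

  sum-parts : ∀ {d} j (v : Vec ℕ d) → sum (parts j v) ≡ wsum′ j v
  sum-parts j []       = refl
  sum-parts j (x ∷ v) =
    trans (sum-++ (replicate x j) _) (cong₂ _+_ (sum-replicate x j) (sum-parts (suc j) v))

  parts-positive : ∀ {d} j → 0 < j → (v : Vec ℕ d) → All (0 <_) (parts j v)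
  parts-positive j 0<j []       = []
  parts-positive j 0<j (x ∷ v) = ++⁺ (replicate⁺ x 0<j) (parts-positive (suc j) (m≤n⇒m≤1+n 0<j) v)

  length≤sum : ∀ {ps} → All (0 <_) ps → length ps ≤ sum ps
  length≤sum []       = z≤n
  length≤sum (p ∷ ps) = +-mono-≤ p (length≤sum ps)

  sum-interleave : ∀ {S U ps} → Interleaving S U ps → sum ps ≡ sum S + sum U
  sum-interleave {S} {U} sp = trans (sum-↭ (toPermutation sp)) (sum-++ S U)

  All-interleaveˡ : ∀ {P : ℕ → Set} {S U ps} → All P ps → Interleaving S U ps → All P S
  All-interleaveˡ []       []          = []
  All-interleaveˡ (p ∷ ps) (consˡ sp) = p ∷ All-interleaveˡ ps sp
  All-interleaveˡ (p ∷ ps) (consʳ sp) = All-interleaveˡ ps sp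

  C*[!*!]≡! : ∀ {n k} → k ≤ n → (n C k) * (k ! * (n ∸ k) !) ≡ n !
  C*[!*!]≡! {n} {k} k≤n = trans (cong (_* (k ! * (n ∸ k) !)) (nCk≡n!/k![n-k]! k≤n))
                                (m/n*n≡m {{k !* (n ∸ k) !≢0}} (k![n∸k]!∣n! k≤n))

  binomProd-≰ : ∀ {d} (v i : Vec ℕ d) → ¬ Pointwise _≤_ i v → binomProd v i ≡ 0
  binomProd-≰ []       []       i≰v = ⊥-elim (i≰v [])
  binomProd-≰ (x ∷ v) (j ∷ i) i≰v with j ≤? x
  ... | no j≰x  = cong (_* binomProd v i) (k>n⇒nCk≡0 (≰⇒> j≰x))
  ... | yes j≤x = trans (cong ((x C j) *_) (binomProd-≰ v i (λ i≤v → i≰v (j≤x ∷ i≤v)))) (*-zeroʳ (x C j))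

  vsum-mono : ∀ {d} {i v : Vec ℕ d} → Pointwise _≤_ i v → vsum i ≤ vsum v
  vsum-mono []          = z≤n
  vsum-mono (x≤y ∷ i≤v) = +-mono-≤ x≤y (vsum-mono i≤v)

  wsum′-mono : ∀ {d} j {i v : Vec ℕ d} → Pointwise _≤_ i v → wsum′ j i ≤ wsum′ j v
  wsum′-mono j []          = z≤n
  wsum′-mono j (x≤y ∷ i≤v) = +-mono-≤ (*-monoʳ-≤ j x≤y) (wsum′-mono (suc j) i≤v)

  vsum≤wsum′ : ∀ {d} j → 0 < j → (i : Vec ℕ d) → vsum i ≤ wsum′ j i
  vsum≤wsum′ j 0<j []       = z≤n
  vsum≤wsum′ j 0<j (x ∷ i) =
    +-mono-≤ (≤-trans (≤-reflexive (sym (*-identityˡ x))) (*-monoˡ-≤ x 0<j)) (vsum≤wsum′ (suc j) (m≤n⇒m≤1+n 0<j) i)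

  ≰replicate⇒<vsum : ∀ {d} (i : Vec ℕ d) l → ¬ Pointwise _≤_ i (Vec.replicate d l) → l < vsum i
  ≰replicate⇒<vsum []       l i≰l = ⊥-elim (i≰l [])
  ≰replicate⇒<vsum (j ∷ i) l i≰l with j ≤? l
  ... | no j≰l  = <-≤-trans (≰⇒> j≰l) (m≤m+n j (vsum i))
  ... | yes j≤l = <-≤-trans (≰replicate⇒<vsum i l (λ i≤l → i≰l (j≤l ∷ i≤l))) (m≤n+m (vsum i) j)

module RingSolver {c ℓ : Level} (R : CommutativeRing c ℓ) where
  open import Data.Nat as ℕ using (zero; suc)
  import Data.Nat.Properties as ℕ
  open import Data.Integer as ℤ using (ℤ; +_; -[1+_]; _⊖_; _◃_; ∣_∣)
  import Data.Integer.Properties as ℤ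
  open import Data.Sign as Sign using (Sign)
  open import Data.Maybe using (Maybe; just; nothing)
  open import Relation.Nullary using (yes; no)
  open import Algebra.Solver.Ring.AlmostCommutativeRing
    using (_-Raw-AlmostCommutative⟶_; fromCommutativeRing)
  open CommutativeRing R
  open import Algebra.Properties.Ring ring using (-‿distribˡ-*; -‿distribʳ-*; -‿involutive; -0#≈0#; -‿+-comm)
  open import Algebra.Properties.Semiring.Mult.TCOptimised semiring using (×-homo-+; ×1-homo-*) renaming (_×_ to _·_)
  open import Relation.Binary.Reasoning.Setoid setoid

  -- With the optimised multiple, fromℤ (+ 0) and fromℤ (+ 1) reduce to 0# and 1#, so goals
  -- stated with 0# and 1# match the solver's semantics of :0 and :1 definitionally.
  fromℤ : ℤ → Carrier
  fromℤ (+ n)      = n · 1#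
  fromℤ -[1+ n ]   = - (suc n · 1#)

  x-y≈[1+x]-[1+y] : ∀ x y → x - y ≈ (1# + x) - (1# + y)
  x-y≈[1+x]-[1+y] x y = begin
    x - y                      ≈⟨ +-identityˡ _ ⟨
    0# + (x - y)               ≈⟨ +-congʳ (-‿inverseʳ 1#) ⟨
    (1# - 1#) + (x - y)        ≈⟨ +-assoc _ _ _ ⟩
    1# + (- 1# + (x - y))      ≈⟨ +-congˡ (+-assoc _ _ _) ⟨
    1# + ((- 1# + x) - y)      ≈⟨ +-congˡ (+-congʳ (+-comm _ _)) ⟩
    1# + ((x - 1#) - y)        ≈⟨ +-congˡ (+-assoc _ _ _) ⟩
    1# + (x + (- 1# - y))      ≈⟨ +-congˡ (+-congˡ (-‿+-comm _ _)) ⟩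
    1# + (x - (1# + y))        ≈⟨ +-assoc _ _ _ ⟨
    (1# + x) - (1# + y)        ∎

  fromℤ-⊖ : ∀ m n → fromℤ (m ⊖ n) ≈ m · 1# - n · 1#
  fromℤ-⊖ zero    zero    = sym (trans (+-identityˡ _) -0#≈0#)
  fromℤ-⊖ zero    (suc n) = sym (+-identityˡ _)
  fromℤ-⊖ (suc m) zero    = sym (trans (+-congˡ -0#≈0#) (+-identityʳ _))
  fromℤ-⊖ (suc m) (suc n) = begin
    fromℤ (suc m ⊖ suc n)            ≡⟨ ≡.cong fromℤ (ℤ.[1+m]⊖[1+n]≡m⊖n m n) ⟩
    fromℤ (m ⊖ n)                    ≈⟨ fromℤ-⊖ m n ⟩
    m · 1# - n · 1#                  ≈⟨ x-y≈[1+x]-[1+y] _ _ ⟩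
    (1# + m · 1#) - (1# + n · 1#)    ≈⟨ +-cong (×-homo-+ 1# 1 m) (-‿cong (×-homo-+ 1# 1 n)) ⟨
    suc m · 1# - suc n · 1#          ∎

  fromℤ-+ : ∀ i j → fromℤ (i ℤ.+ j) ≈ fromℤ i + fromℤ j
  fromℤ-+ (+ m)      (+ n)      = ×-homo-+ 1# m n
  fromℤ-+ (+ m)      -[1+ n ]   = fromℤ-⊖ m (suc n)
  fromℤ-+ -[1+ m ]   (+ n)      = trans (fromℤ-⊖ n (suc m)) (+-comm _ _)
  fromℤ-+ -[1+ m ]   -[1+ n ]   = begin
    - (suc (suc (m ℕ.+ n)) · 1#)         ≡⟨ ≡.cong (λ k → - (k · 1#)) (≡.sym (ℕ.+-suc (suc m) n)) ⟩
    - ((suc m ℕ.+ suc n) · 1#)           ≈⟨ -‿cong (×-homo-+ 1# (suc m) (suc n)) ⟩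
    - (suc m · 1# + suc n · 1#)          ≈⟨ -‿+-comm _ _ ⟨
    - (suc m · 1#) + - (suc n · 1#)      ∎

  signed : Sign → Carrier → Carrier
  signed Sign.+ x = x
  signed Sign.- x = - x

  signed-cong : ∀ s {x y} → x ≈ y → signed s x ≈ signed s y
  signed-cong Sign.+ x≈y = x≈y
  signed-cong Sign.- x≈y = -‿cong x≈y

  signed-* : ∀ s t x y → signed (s Sign.* t) (x * y) ≈ signed s x * signed t y
  signed-* Sign.+ Sign.+ x y = refl
  signed-* Sign.+ Sign.- x y = -‿distribʳ-* x y
  signed-* Sign.- Sign.+ x y = -‿distribˡ-* x y
  signed-* Sign.- Sign.- x y = begin
    x * y               ≈⟨ -‿involutive _ ⟨
    - - (x * y)         ≈⟨ -‿cong (-‿distribʳ-* x y) ⟩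
    - (x * - y)         ≈⟨ -‿distribˡ-* x (- y) ⟩
    - x * - y           ∎

  fromℤ-◃ : ∀ s n → fromℤ (s ◃ n) ≈ signed s (n · 1#)
  fromℤ-◃ Sign.+ zero    = refl
  fromℤ-◃ Sign.- zero    = sym -0#≈0#
  fromℤ-◃ Sign.+ (suc n) = refl
  fromℤ-◃ Sign.- (suc n) = refl

  fromℤ-signAbs : ∀ i → fromℤ i ≈ signed (ℤ.sign i) (∣ i ∣ · 1#)
  fromℤ-signAbs (+ zero)    = refl
  fromℤ-signAbs (+ suc n)   = refl
  fromℤ-signAbs -[1+ n ]    = refl

  fromℤ-* : ∀ i j → fromℤ (i ℤ.* j) ≈ fromℤ i * fromℤ j
  fromℤ-* i j = begin
    fromℤ (i ℤ.* j)                                 ≈⟨ fromℤ-◃ (s Sign.* t) (∣ i ∣ ℕ.* ∣ j ∣) ⟩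
    signed (s Sign.* t) ((∣ i ∣ ℕ.* ∣ j ∣) · 1#)    ≈⟨ signed-cong (s Sign.* t) (×1-homo-* ∣ i ∣ ∣ j ∣) ⟩
    signed (s Sign.* t) (∣ i ∣ · 1# * ∣ j ∣ · 1#)   ≈⟨ signed-* s t _ _ ⟩
    signed s (∣ i ∣ · 1#) * signed t (∣ j ∣ · 1#)   ≈⟨ *-cong (fromℤ-signAbs i) (fromℤ-signAbs j) ⟨
    fromℤ i * fromℤ j                               ∎
    where s = ℤ.sign i; t = ℤ.sign j

  fromℤ-neg : ∀ i → fromℤ (ℤ.- i) ≈ - fromℤ i
  fromℤ-neg (+ zero)  = sym -0#≈0#
  fromℤ-neg (+ suc n) = refl
  fromℤ-neg -[1+ n ]  = sym (-‿involutive _)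

  morphism : ℤ.+-*-rawRing -Raw-AlmostCommutative⟶ fromCommutativeRing R
  morphism = record
    { ⟦_⟧ = fromℤ ; +-homo = fromℤ-+ ; *-homo = fromℤ-* ; -‿homo = fromℤ-neg
    ; 0-homo = refl ; 1-homo = refl }

  fromℤ-≟ : ∀ i j → Maybe (fromℤ i ≈ fromℤ j)
  fromℤ-≟ i j with i ℤ.≟ j
  ... | yes ≡.refl = just refl
  ... | no _       = nothing

  open import Algebra.Solver.Ring ℤ.+-*-rawRing (fromCommutativeRing R) morphism fromℤ-≟ public
    using (Polynomial; solve; con; _:+_; _:*_; _:-_; :-_; _:=_)

  :0 :1 : ∀ {n} → Polynomial n
  :0 = con (+ 0)
  :1 = con (+ 1)

module Identity {c ℓ : Level} (F : Char0Field c ℓ) where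
  open import Data.Nat as ℕ using (zero; suc; z≤n; s≤s; _!)
  import Data.Nat.Properties as ℕ
  open import Data.Nat.ListAction using (sum)
  open import Data.Nat.Combinatorics using (k>n⇒nCk≡0; nCk+nC[k+1]≡[n+1]C[k+1])
  open import Data.List as List using (List; []; _∷_; _++_; length; foldr; replicate; concatMap; applyUpTo; filter)
  open import Data.Vec using ([]; _∷_)
  import Data.Vec as Vec
  open import Data.Vec.Relation.Binary.Pointwise.Inductive as Pointwise using (Pointwise)
  open import Data.List.Relation.Ternary.Interleaving.Propositional
    using (Interleaving; []; consˡ; consʳ)
  open import Data.Product using (_,_; proj₁; proj₂)
  open import Data.Sum using (inj₁; inj₂)
  open import Data.Bool using (true; false; if_then_else_)
  open import Function using (_∘_; id)
  open import Relation.Nullary using (yes; no; does)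
  open import Relation.Nullary.Decidable using (_×-dec_; dec-true; dec-false)
  open import Relation.Unary using (Decidable)
  open import Relation.Binary.PropositionalEquality using (_≢_)
  open Combinatorics
  open FieldOps F
  open RingSolver cring
  open import Algebra.Properties.Ring ring using (-‿+-comm; -0#≈0#)
  open import Relation.Binary.Reasoning.Setoid setoid

  ⁻¹-unique : ∀ {x y} → x ≉ 0# → x * y ≈ 1# → y ≈ x ⁻¹
  ⁻¹-unique {x} {y} x≉0 xy≈1 = begin
    y                  ≈⟨ *-identityʳ y ⟨
    y * 1#             ≈⟨ *-congˡ (⁻¹-inverse x x≉0) ⟨
    y * (x * x ⁻¹)     ≈⟨ *-assoc _ _ _ ⟨
    (y * x) * x ⁻¹     ≈⟨ *-congʳ (trans (*-comm y x) xy≈1) ⟩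
    1# * x ⁻¹          ≈⟨ *-identityˡ _ ⟩
    x ⁻¹               ∎

  *-≉0 : ∀ {x y} → x ≉ 0# → y ≉ 0# → x * y ≉ 0#
  *-≉0 {x} {y} x≉0 y≉0 xy≈0 = y≉0 (begin
    y                  ≈⟨ *-identityˡ y ⟨
    1# * y             ≈⟨ *-congʳ (trans (*-comm _ _) (⁻¹-inverse x x≉0)) ⟨
    (x ⁻¹ * x) * y     ≈⟨ *-assoc _ _ _ ⟩
    x ⁻¹ * (x * y)     ≈⟨ *-congˡ xy≈0 ⟩
    x ⁻¹ * 0#          ≈⟨ zeroʳ _ ⟩
    0#                 ∎)

  ⁻¹-distrib-* : ∀ {x y} → x ≉ 0# → y ≉ 0# → (x * y) ⁻¹ ≈ x ⁻¹ * y ⁻¹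
  ⁻¹-distrib-* {x} {y} x≉0 y≉0 = sym (⁻¹-unique (*-≉0 x≉0 y≉0) (begin
    (x * y) * (x ⁻¹ * y ⁻¹)     ≈⟨ solve 4 (λ x y x′ y′ → (x :* y) :* (x′ :* y′) := (x :* x′) :* (y :* y′)) refl x y (x ⁻¹) (y ⁻¹) ⟩
    (x * x ⁻¹) * (y * y ⁻¹)     ≈⟨ *-cong (⁻¹-inverse x x≉0) (⁻¹-inverse y y≉0) ⟩
    1# * 1#                     ≈⟨ *-identityʳ _ ⟩
    1#                          ∎))

  ⁻¹-cong : ∀ {x y} → x ≈ y → x ≉ 0# → x ⁻¹ ≈ y ⁻¹
  ⁻¹-cong x≈y x≉0 = ⁻¹-unique (λ y≈0 → x≉0 (trans x≈y y≈0)) (trans (*-congʳ (sym x≈y)) (⁻¹-inverse _ x≉0))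

  *⁻¹-cancelʳ : ∀ {x} y → x ≉ 0# → (y * x) * x ⁻¹ ≈ y
  *⁻¹-cancelʳ {x} y x≉0 = trans (*-assoc _ _ _) (trans (*-congˡ (⁻¹-inverse x x≉0)) (*-identityʳ y))

  ⁻¹+⁻¹ : ∀ {x y} → x ≉ 0# → y ≉ 0# → x ⁻¹ + y ⁻¹ ≈ (y + x) ÷ (x * y)
  ⁻¹+⁻¹ {x} {y} x≉0 y≉0 = begin
    x ⁻¹ + y ⁻¹                                  ≈⟨ +-cong (*-identityˡ _) (*-identityˡ _) ⟨
    1# * x ⁻¹ + 1# * y ⁻¹                        ≈⟨ +-cong (*-congʳ (⁻¹-inverse y y≉0)) (*-congʳ (⁻¹-inverse x x≉0)) ⟨
    (y * y ⁻¹) * x ⁻¹ + (x * x ⁻¹) * y ⁻¹        ≈⟨ solve 4 (λ x y x′ y′ → (y :* y′) :* x′ :+ (x :* x′) :* y′ := (y :+ x) :* (x′ :* y′)) refl x y (x ⁻¹) (y ⁻¹) ⟩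
    (y + x) * (x ⁻¹ * y ⁻¹)                      ≈⟨ *-congˡ (⁻¹-distrib-* x≉0 y≉0) ⟨
    (y + x) ÷ (x * y)                            ∎

  fromℕ-+ : ∀ m n → fromℕ (m ℕ.+ n) ≈ fromℕ m + fromℕ n
  fromℕ-+ zero    n = sym (+-identityˡ _)
  fromℕ-+ (suc m) n = trans (+-congˡ (fromℕ-+ m n)) (sym (+-assoc _ _ _))

  fromℕ-* : ∀ m n → fromℕ (m ℕ.* n) ≈ fromℕ m * fromℕ n
  fromℕ-* zero    n = sym (zeroˡ _)
  fromℕ-* (suc m) n = begin
    fromℕ (n ℕ.+ m ℕ.* n)             ≈⟨ fromℕ-+ n (m ℕ.* n) ⟩
    fromℕ n + fromℕ (m ℕ.* n)         ≈⟨ +-cong (sym (*-identityˡ _)) (fromℕ-* m n) ⟩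
    1# * fromℕ n + fromℕ m * fromℕ n  ≈⟨ distribʳ _ _ _ ⟨
    (1# + fromℕ m) * fromℕ n          ∎

  fromℕ-≉0 : ∀ n → .{{ℕ.NonZero n}} → fromℕ n ≉ 0#
  fromℕ-≉0 (suc n) = char0 n

  factorial≡! : ∀ n → factorial n ≡ n !
  factorial≡! zero    = ≡.refl
  factorial≡! (suc n) = ≡.cong (suc n ℕ.*_) (factorial≡! n)

  fromℕ-C≉0 : ∀ {n k} → k ℕ.≤ n → fromℕ (n C k) ≉ 0#
  fromℕ-C≉0 {n} {k} k≤n = fromℕ-≉0 (n C k) {{ℕ.m*n≢0⇒m≢0 (n C k) {{≡.subst ℕ.NonZero (≡.sym (C*[!*!]≡! k≤n)) (n ℕ.!≢0)}}}}

  fromℕ-factorial≉0 : ∀ n → fromℕ (factorial n) ≉ 0#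
  fromℕ-factorial≉0 n = fromℕ-≉0 (factorial n) {{≡.subst ℕ.NonZero (≡.sym (factorial≡! n)) (n ℕ.!≢0)}}

  falling-cong : ∀ {x y} j → x ≈ y → falling x j ≈ falling y j
  falling-cong zero    x≈y = refl
  falling-cong (suc j) x≈y = *-cong (falling-cong j x≈y) (+-congʳ x≈y)

  falling-sucˡ : ∀ x j → falling x (suc j) ≈ x * falling (x - 1#) j
  falling-sucˡ x zero    = solve 1 (λ x → :1 :* (x :- :0) := x :* :1) refl x
  falling-sucˡ x (suc j) = begin
    falling x (suc j) * (x - (1# + fromℕ j))          ≈⟨ *-congʳ (falling-sucˡ x j) ⟩
    (x * falling (x - 1#) j) * (x - (1# + fromℕ j))   ≈⟨ solve 3 (λ x f j → (x :* f) :* (x :- (:1 :+ j)) := x :* (f :* ((x :- :1) :- j))) refl x (falling (x - 1#) j) (fromℕ j) ⟩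
    x * (falling (x - 1#) j * ((x - 1#) - fromℕ j))   ∎

  falling-+-suc : ∀ d x u →
    falling (d + x) (suc u) ≈ d * falling ((d - 1#) + x) u + x * falling (d + (x - 1#)) u
  falling-+-suc d x u = begin
    falling (d + x) (suc u)                                       ≈⟨ falling-sucˡ (d + x) u ⟩
    (d + x) * falling ((d + x) - 1#) u                            ≈⟨ distribʳ _ _ _ ⟩
    d * falling ((d + x) - 1#) u + x * falling ((d + x) - 1#) u   ≈⟨ +-cong (*-congˡ (falling-cong u (solve 2 (λ d x → (d :+ x) :- :1 := (d :- :1) :+ x) refl d x)))
                                                                            (*-congˡ (falling-cong u (solve 2 (λ d x → (d :+ x) :- :1 := d :+ (x :- :1)) refl d x))) ⟩
    d * falling ((d - 1#) + x) u + x * falling (d + (x - 1#)) u   ∎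

  summand : Carrier → Carrier → ℕ → ℕ → Carrier
  summand τ x k l = ((τ * binom x (k ∸ l)) * binom (τ - x) l) ÷ ((x * (τ - x)) * fromℕ (k C l))

  -- τ / (x (τ - x)) = 1 / x + 1 / (τ - x), and (k - l)! l! C(k, l) = k!.
  summand-partialFractions : ∀ τ x k l → l ℕ.≤ k → x ≉ 0# → τ - x ≉ 0# →
    summand τ x k l ≈ fromℕ (factorial k) ⁻¹ *
      (falling x (k ∸ l) * falling (τ - x) l * x ⁻¹ + falling x (k ∸ l) * falling (τ - x) l * (τ - x) ⁻¹)
  summand-partialFractions τ x k l l≤k x≉0 y≉0 = begin
    ((τ * (fx * [k∸l]! ⁻¹)) * (fy * l! ⁻¹)) * ((x * y) * kCl) ⁻¹
      ≈⟨ *-cong (*-congʳ (*-congʳ τ≈x+y)) (trans (⁻¹-distrib-* (*-≉0 x≉0 y≉0) kCl≉0) (*-congʳ (⁻¹-distrib-* x≉0 y≉0))) ⟩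
    (((x + y) * (fx * [k∸l]! ⁻¹)) * (fy * l! ⁻¹)) * ((x ⁻¹ * y ⁻¹) * kCl ⁻¹)
      ≈⟨ solve 9 (λ x y fx fy a b c x′ y′ → (((x :+ y) :* (fx :* a)) :* (fy :* b)) :* ((x′ :* y′) :* c) :=
                   (a :* (b :* c)) :* ((fx :* fy :* x′) :* (y :* y′) :+ (fx :* fy :* y′) :* (x :* x′)))
                 refl x y fx fy ([k∸l]! ⁻¹) (l! ⁻¹) (kCl ⁻¹) (x ⁻¹) (y ⁻¹) ⟩
    ([k∸l]! ⁻¹ * (l! ⁻¹ * kCl ⁻¹)) * ((fx * fy * x ⁻¹) * (y * y ⁻¹) + (fx * fy * y ⁻¹) * (x * x ⁻¹))
      ≈⟨ *-cong denominator⁻¹≈ (+-cong (trans (*-congˡ (⁻¹-inverse y y≉0)) (*-identityʳ _))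
                                       (trans (*-congˡ (⁻¹-inverse x x≉0)) (*-identityʳ _))) ⟩
    fromℕ (factorial k) ⁻¹ * (fx * fy * x ⁻¹ + fx * fy * y ⁻¹)
      ∎
    where
    y fx fy [k∸l]! l! kCl : Carrier
    y = τ - x
    fx = falling x (k ∸ l)
    fy = falling y l
    [k∸l]! = fromℕ (factorial (k ∸ l))
    l! = fromℕ (factorial l)
    kCl = fromℕ (k C l)

    kCl≉0 : kCl ≉ 0#
    kCl≉0 = fromℕ-C≉0 l≤k

    l!kCl≉0 : l! * kCl ≉ 0#
    l!kCl≉0 = *-≉0 (fromℕ-factorial≉0 l) kCl≉0

    τ≈x+y : τ ≈ x + y
    τ≈x+y = solve 2 (λ τ x → τ := x :+ (τ :- x)) refl τ x

    denominator≈ : [k∸l]! * (l! * kCl) ≈ fromℕ (factorial k)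
    denominator≈ = begin
      [k∸l]! * (l! * kCl)                                        ≈⟨ solve 3 (λ a b c → a :* (b :* c) := c :* (b :* a)) refl [k∸l]! l! kCl ⟩
      kCl * (l! * [k∸l]!)                                        ≈⟨ *-congˡ (fromℕ-* (factorial l) (factorial (k ∸ l))) ⟨
      kCl * fromℕ (factorial l ℕ.* factorial (k ∸ l))            ≈⟨ fromℕ-* (k C l) _ ⟨
      fromℕ ((k C l) ℕ.* (factorial l ℕ.* factorial (k ∸ l)))    ≡⟨ ≡.cong fromℕ (≡.trans
                                                                      (≡.cong₂ (λ s t → (k C l) ℕ.* (s ℕ.* t)) (factorial≡! l) (factorial≡! (k ∸ l)))
                                                                      (≡.trans (C*[!*!]≡! l≤k) (≡.sym (factorial≡! k)))) ⟩
      fromℕ (factorial k)                                        ∎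

    denominator⁻¹≈ : [k∸l]! ⁻¹ * (l! ⁻¹ * kCl ⁻¹) ≈ fromℕ (factorial k) ⁻¹
    denominator⁻¹≈ = begin
      [k∸l]! ⁻¹ * (l! ⁻¹ * kCl ⁻¹)    ≈⟨ *-congˡ (⁻¹-distrib-* (fromℕ-factorial≉0 l) kCl≉0) ⟨
      [k∸l]! ⁻¹ * (l! * kCl) ⁻¹       ≈⟨ ⁻¹-distrib-* (fromℕ-factorial≉0 (k ∸ l)) l!kCl≉0 ⟨
      ([k∸l]! * (l! * kCl)) ⁻¹        ≈⟨ ⁻¹-cong denominator≈ (*-≉0 (fromℕ-factorial≉0 (k ∸ l)) l!kCl≉0) ⟩
      fromℕ (factorial k) ⁻¹          ∎

  -- Sums over the splittings of a list

  Σsplit : List ℕ → (List ℕ → List ℕ → Carrier) → Carrier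
  Σsplit []       f = f [] []
  Σsplit (p ∷ ps) f = Σsplit ps (λ S U → f (p ∷ S) U) + Σsplit ps (λ S U → f S (p ∷ U))

  Σsplit-cong : ∀ ps {f g : List ℕ → List ℕ → Carrier} →
                (∀ {S U} → Interleaving S U ps → f S U ≈ g S U) → Σsplit ps f ≈ Σsplit ps g
  Σsplit-cong []       f≈g = f≈g []
  Σsplit-cong (p ∷ ps) f≈g = +-cong (Σsplit-cong ps (λ sp → f≈g (consˡ sp))) (Σsplit-cong ps (λ sp → f≈g (consʳ sp)))

  Σsplit-+ : ∀ ps (f g : List ℕ → List ℕ → Carrier) →
             Σsplit ps (λ S U → f S U + g S U) ≈ Σsplit ps f + Σsplit ps g
  Σsplit-+ []       f g = refl
  Σsplit-+ (p ∷ ps) f g = trans (+-cong (Σsplit-+ ps _ _) (Σsplit-+ ps _ _))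
    (solve 4 (λ a b c d → (a :+ b) :+ (c :+ d) := (a :+ c) :+ (b :+ d)) refl _ _ _ _)

  Σsplit-*ˡ : ∀ ps x (f : List ℕ → List ℕ → Carrier) → Σsplit ps (λ S U → x * f S U) ≈ x * Σsplit ps f
  Σsplit-*ˡ []       x f = refl
  Σsplit-*ˡ (p ∷ ps) x f = trans (+-cong (Σsplit-*ˡ ps x _) (Σsplit-*ˡ ps x _)) (sym (distribˡ _ _ _))

  Σsplit-neg : ∀ ps (f : List ℕ → List ℕ → Carrier) → Σsplit ps (λ S U → - f S U) ≈ - Σsplit ps f
  Σsplit-neg []       f = refl
  Σsplit-neg (p ∷ ps) f = trans (+-cong (Σsplit-neg ps _) (Σsplit-neg ps _)) (-‿+-comm _ _)

  Σsplit-0 : ∀ ps → Σsplit ps (λ _ _ → 0#) ≈ 0#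
  Σsplit-0 []       = refl
  Σsplit-0 (p ∷ ps) = trans (+-cong (Σsplit-0 ps) (Σsplit-0 ps)) (+-identityʳ _)

  Σsplit-swap : ∀ ps (f : List ℕ → List ℕ → Carrier) → Σsplit ps f ≈ Σsplit ps (λ S U → f U S)
  Σsplit-swap []       f = refl
  Σsplit-swap (p ∷ ps) f = trans (+-cong (Σsplit-swap ps _) (Σsplit-swap ps _)) (+-comm _ _)

  whenEmpty : List ℕ → Carrier → Carrier
  whenEmpty []      x = x
  whenEmpty (_ ∷ _) x = 0#

  Σsplit-whenEmpty : ∀ ps x → Σsplit ps (λ S U → whenEmpty S x) ≈ x
  Σsplit-whenEmpty []       x = refl
  Σsplit-whenEmpty (p ∷ ps) x = trans (+-cong (Σsplit-0 ps) (Σsplit-whenEmpty ps x)) (+-identityˡ x)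

  Σsplit-whenEmptyʳ : ∀ ps x → Σsplit ps (λ S U → whenEmpty U x) ≈ x
  Σsplit-whenEmptyʳ ps x = trans (Σsplit-swap ps _) (Σsplit-whenEmpty ps x)

  Σsub : List ℕ → (ℕ → ℕ → ℕ → ℕ → Carrier) → Carrier
  Σsub ps f = Σsplit ps (λ S U → f (length S) (sum S) (length U) (sum U))

  module Abel (b₁ b₂ : Carrier) where
    open import Data.List.Relation.Ternary.Interleaving.Properties using (interleave-length)
    open import Data.List.Relation.Unary.All using (All)
    open import Algebra.Properties.CommutativeSemigroup ℕ.+-commutativeSemigroup using (x∙yz≈y∙xz)

    κ : ℕ → ℕ → Carrier
    κ l m = b₁ * fromℕ l + b₂ * fromℕ m

    κ-+ : ∀ l u m w → κ (l ℕ.+ u) (m ℕ.+ w) ≈ κ l m + κ u w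
    κ-+ l u m w = begin
      b₁ * fromℕ (l ℕ.+ u) + b₂ * fromℕ (m ℕ.+ w)             ≈⟨ +-cong (*-congˡ (fromℕ-+ l u)) (*-congˡ (fromℕ-+ m w)) ⟩
      b₁ * (fromℕ l + fromℕ u) + b₂ * (fromℕ m + fromℕ w)     ≈⟨ solve 6 (λ b₁ b₂ l u m w → b₁ :* (l :+ u) :+ b₂ :* (m :+ w) := (b₁ :* l :+ b₂ :* m) :+ (b₁ :* u :+ b₂ :* w)) refl b₁ b₂ (fromℕ l) (fromℕ u) (fromℕ m) (fromℕ w) ⟩
      κ l m + κ u w                                           ∎

    κ-zero : κ 0 0 ≈ 0#
    κ-zero = solve 2 (λ b₁ b₂ → b₁ :* :0 :+ b₂ :* :0 := :0) refl b₁ b₂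

    x+κ-zero : ∀ x → x + κ 0 0 ≈ x
    x+κ-zero x = trans (+-congˡ κ-zero) (+-identityʳ x)

    κ[_] : List ℕ → Carrier
    κ[ R ] = κ (length R) (sum R)

    κ-interleave : ∀ {ps S U} → Interleaving S U ps → κ[ ps ] ≈ κ[ S ] + κ[ U ]
    κ-interleave {ps} {S} {U} sp = begin
      κ[ ps ]                                          ≡⟨ ≡.cong₂ κ (interleave-length sp) (sum-interleave sp) ⟩
      κ (length S ℕ.+ length U) (sum S ℕ.+ sum U)      ≈⟨ κ-+ (length S) (length U) (sum S) (sum U) ⟩
      κ[ S ] + κ[ U ]                                  ∎

    -- Vandermonde's convolution (δ + x)_u = Σ_i C(u, i) (δ)_i (x)_{u-i} applied termwise:
    -- I is the part of the complement of S that receives the factors of (δ)_i.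
    Σsub-vandermonde : ∀ ps δ (X : ℕ → ℕ → Carrier) (G : ℕ → ℕ → ℕ → ℕ → Carrier) →
      Σsub ps (λ l m u w → falling (δ + X l m) u * G l m u w) ≈
      Σsplit ps (λ I R → falling δ (length I) *
        Σsub R (λ l m u w → falling (X l m) u * G l m (length I ℕ.+ u) (sum I ℕ.+ w)))
    Σsub-vandermonde []       δ X G = *-congˡ (sym (*-identityˡ _))
    Σsub-vandermonde (p ∷ ps) δ X G = begin
      A + B               ≈⟨ +-cong (Σsub-vandermonde ps δ (λ l m → X (suc l) (p ℕ.+ m)) (λ l m u w → G (suc l) (p ℕ.+ m) u w)) B≈B₁+B₂ ⟩
      Z₁ + (B₁ + B₂)      ≈⟨ +-congˡ (+-cong (Σsub-vandermonde ps (δ - 1#) X G₁) (Σsub-vandermonde ps δ (λ l m → X l m - 1#) G₂)) ⟩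
      Z₁ + (B₁′ + B₂′)    ≈⟨ +-congˡ (+-cong B₁′≈Y B₂′≈Z₂) ⟩
      Z₁ + (Y + Z₂)       ≈⟨ solve 3 (λ a b c → a :+ (b :+ c) := b :+ (a :+ c)) refl Z₁ Y Z₂ ⟩
      Y + (Z₁ + Z₂)       ≈⟨ +-congˡ (trans (Σsplit-cong ps (λ _ → distribˡ _ _ _)) (Σsplit-+ ps _ _)) ⟨
      Y + Z               ∎
      where
      A B B₁ B₂ B₁′ B₂′ Y Z Z₁ Z₂ : Carrier
      G₁ G₂ : ℕ → ℕ → ℕ → ℕ → Carrier
      G₁ l m u w = δ * G l m (suc u) (p ℕ.+ w)
      G₂ l m u w = X l m * G l m (suc u) (p ℕ.+ w)
      A = Σsub ps (λ l m u w → falling (δ + X (suc l) (p ℕ.+ m)) u * G (suc l) (p ℕ.+ m) u w)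
      B = Σsub ps (λ l m u w → falling (δ + X l m) (suc u) * G l m (suc u) (p ℕ.+ w))
      B₁ = Σsub ps (λ l m u w → falling ((δ - 1#) + X l m) u * G₁ l m u w)
      B₂ = Σsub ps (λ l m u w → falling (δ + (X l m - 1#)) u * G₂ l m u w)
      B₁′ = Σsplit ps (λ I R → falling (δ - 1#) (length I) *
        Σsub R (λ l m u w → falling (X l m) u * G₁ l m (length I ℕ.+ u) (sum I ℕ.+ w)))
      B₂′ = Σsplit ps (λ I R → falling δ (length I) *
        Σsub R (λ l m u w → falling (X l m - 1#) u * G₂ l m (length I ℕ.+ u) (sum I ℕ.+ w)))
      Y = Σsplit ps (λ I R → falling δ (suc (length I)) *
        Σsub R (λ l m u w → falling (X l m) u * G l m (suc (length I) ℕ.+ u) ((p ℕ.+ sum I) ℕ.+ w)))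
      Z = Σsplit ps (λ I R → falling δ (length I) *
        Σsub (p ∷ R) (λ l m u w → falling (X l m) u * G l m (length I ℕ.+ u) (sum I ℕ.+ w)))
      Z₁ = Σsplit ps (λ I R → falling δ (length I) *
        Σsub R (λ l m u w → falling (X (suc l) (p ℕ.+ m)) u * G (suc l) (p ℕ.+ m) (length I ℕ.+ u) (sum I ℕ.+ w)))
      Z₂ = Σsplit ps (λ I R → falling δ (length I) *
        Σsub R (λ l m u w → falling (X l m) (suc u) * G l m (length I ℕ.+ suc u) (sum I ℕ.+ (p ℕ.+ w))))

      B≈B₁+B₂ : B ≈ B₁ + B₂
      B≈B₁+B₂ = trans (Σsplit-cong ps (λ {S} {U} _ → trans (*-congʳ (falling-+-suc δ (X (length S) (sum S)) (length U)))
        (solve 5 (λ d x f₁ f₂ g → (d :* f₁ :+ x :* f₂) :* g := f₁ :* (d :* g) :+ f₂ :* (x :* g)) refl δ _ _ _ _)))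
        (Σsplit-+ ps _ _)

      B₁′≈Y : B₁′ ≈ Y
      B₁′≈Y = Σsplit-cong ps λ {I} {R} _ → begin
        falling (δ - 1#) (length I) * Σsub R (λ l m u w → falling (X l m) u * G₁ l m (length I ℕ.+ u) (sum I ℕ.+ w))
          ≈⟨ *-congˡ (Σsplit-cong R (λ {S} {U} _ → trans (solve 3 (λ f d g → f :* (d :* g) := d :* (f :* g)) refl _ δ _)
               (*-congˡ (*-congˡ (reflexive (≡.cong (G (length S) (sum S) _) (≡.sym (ℕ.+-assoc p (sum I) (sum U))))))))) ⟩
        falling (δ - 1#) (length I) * Σsplit R (λ S U → δ * (falling (X (length S) (sum S)) (length U) *
          G (length S) (sum S) (suc (length I) ℕ.+ length U) ((p ℕ.+ sum I) ℕ.+ sum U)))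
          ≈⟨ *-congˡ (Σsplit-*ˡ R δ _) ⟩
        falling (δ - 1#) (length I) * (δ * Σsub R (λ l m u w → falling (X l m) u * G l m (suc (length I) ℕ.+ u) ((p ℕ.+ sum I) ℕ.+ w)))
          ≈⟨ solve 3 (λ f d s → f :* (d :* s) := (d :* f) :* s) refl _ δ _ ⟩
        (δ * falling (δ - 1#) (length I)) * Σsub R (λ l m u w → falling (X l m) u * G l m (suc (length I) ℕ.+ u) ((p ℕ.+ sum I) ℕ.+ w))
          ≈⟨ *-congʳ (falling-sucˡ δ (length I)) ⟨
        falling δ (suc (length I)) * Σsub R (λ l m u w → falling (X l m) u * G l m (suc (length I) ℕ.+ u) ((p ℕ.+ sum I) ℕ.+ w))
          ∎

      B₂′≈Z₂ : B₂′ ≈ Z₂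
      B₂′≈Z₂ = Σsplit-cong ps λ {I} {R} _ → *-congˡ (Σsplit-cong R λ {S} {U} _ → begin
        falling (X (length S) (sum S) - 1#) (length U) * (X (length S) (sum S) *
          G (length S) (sum S) (suc (length I ℕ.+ length U)) (p ℕ.+ (sum I ℕ.+ sum U)))
          ≈⟨ solve 3 (λ f x g → f :* (x :* g) := (x :* f) :* g) refl _ _ _ ⟩
        (X (length S) (sum S) * falling (X (length S) (sum S) - 1#) (length U)) *
          G (length S) (sum S) (suc (length I ℕ.+ length U)) (p ℕ.+ (sum I ℕ.+ sum U))
          ≈⟨ *-cong (sym (falling-sucˡ (X (length S) (sum S)) (length U))) (reflexive (≡.cong₂ (G (length S) (sum S))
               (≡.sym (ℕ.+-suc (length I) (length U))) (x∙yz≈y∙xz p (sum I) (sum U)))) ⟩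
        falling (X (length S) (sum S)) (suc (length U)) *
          G (length S) (sum S) (length I ℕ.+ suc (length U)) (sum I ℕ.+ (p ℕ.+ sum U))
          ∎)

    mixedSum : List ℕ → Carrier → Carrier → Carrier
    mixedSum R x y = Σsub R (λ l m u w → falling (x + κ l m) u * falling (y + κ u w) l)

    mixedSum-cong : ∀ R {x x′ y y′} → x ≈ x′ → y ≈ y′ → mixedSum R x y ≈ mixedSum R x′ y′
    mixedSum-cong R x≈x′ y≈y′ = Σsplit-cong R λ {S} {U} _ →
      *-cong (falling-cong (length U) (+-congʳ x≈x′)) (falling-cong (length S) (+-congʳ y≈y′))

    mixedSum-comm : ∀ R x y → mixedSum R x y ≈ mixedSum R y x
    mixedSum-comm R x y = trans (Σsplit-swap R _) (Σsplit-cong R (λ _ → *-comm _ _))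

    mixedSum-expand : ∀ R x y δ →
      mixedSum R (x + δ) y ≈ Σsplit R (λ I R′ → falling δ (length I) * mixedSum R′ x (y + κ[ I ]))
    mixedSum-expand R x y δ = begin
      mixedSum R (x + δ) y
        ≈⟨ Σsplit-cong R (λ {S} {U} _ → *-congʳ (falling-cong (length U) (solve 3 (λ x δ k → (x :+ δ) :+ k := δ :+ (x :+ k)) refl x δ κ[ S ]))) ⟩
      Σsub R (λ l m u w → falling (δ + (x + κ l m)) u * falling (y + κ u w) l)
        ≈⟨ Σsub-vandermonde R δ (λ l m → x + κ l m) (λ l m u w → falling (y + κ u w) l) ⟩
      Σsplit R (λ I R′ → falling δ (length I) * Σsub R′ (λ l m u w →
        falling (x + κ l m) u * falling (y + κ (length I ℕ.+ u) (sum I ℕ.+ w)) l))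
        ≈⟨ Σsplit-cong R (λ {I} {R′} _ → *-congˡ (Σsplit-cong R′ λ {S} {U} _ → *-congˡ (falling-cong (length S)
             (trans (+-congˡ (κ-+ (length I) (length U) (sum I) (sum U))) (sym (+-assoc _ _ _)))))) ⟩
      Σsplit R (λ I R′ → falling δ (length I) * mixedSum R′ x (y + κ[ I ]))
        ∎

    mixedSum-transfer : ∀ R x y δ → mixedSum R (x + δ) y ≈ mixedSum R x (y + δ)
    mixedSum-transfer R = go (length R) R ℕ.≤-refl
      where
      go : ∀ n R → length R ℕ.≤ n → ∀ x y δ → mixedSum R (x + δ) y ≈ mixedSum R x (y + δ)
      go zero    []      _     x y δ = refl
      go (suc n) R |R|≤1+n x y δ = begin
        mixedSum R (x + δ) y                                                      ≈⟨ mixedSum-expand R x y δ ⟩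
        Σsplit R (λ I R′ → falling δ (length I) * mixedSum R′ x (y + κ[ I ]))     ≈⟨ Σsplit-cong R (λ sp → *-congˡ (exchange sp)) ⟩
        Σsplit R (λ I R′ → falling δ (length I) * mixedSum R′ y (x + κ[ I ]))     ≈⟨ mixedSum-expand R y x δ ⟨
        mixedSum R (y + δ) x                                                      ≈⟨ mixedSum-comm R _ _ ⟩
        mixedSum R x (y + δ)                                                      ∎
        where
        exchange : ∀ {I R′} → Interleaving I R′ R → mixedSum R′ x (y + κ[ I ]) ≈ mixedSum R′ y (x + κ[ I ])
        exchange {[]}    {R′} _  = begin
          mixedSum R′ x (y + κ 0 0)    ≈⟨ mixedSum-cong R′ refl (x+κ-zero y) ⟩
          mixedSum R′ x y              ≈⟨ mixedSum-comm R′ x y ⟩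
          mixedSum R′ y x              ≈⟨ mixedSum-cong R′ refl (x+κ-zero x) ⟨
          mixedSum R′ y (x + κ 0 0)    ∎
        exchange {q ∷ I} {R′} sp = trans (sym (go n R′ |R′|≤n x y κ[ q ∷ I ])) (mixedSum-comm R′ _ _)
          where
          |R′|≤n : length R′ ℕ.≤ n
          |R′|≤n = ℕ.≤-pred (ℕ.≤-trans (s≤s (ℕ.m≤n+m (length R′) (length I)))
                                       (ℕ.≤-trans (ℕ.≤-reflexive (≡.sym (interleave-length sp))) |R|≤1+n))

    diffSum : List ℕ → Carrier → Carrier → Carrier
    diffSum R x y = Σsub R (λ l m u w → falling (x + κ l m) u * falling (y - κ l m) l)

    diffSum≈mixedSum : ∀ R x y → diffSum R x y ≈ mixedSum R x (y - κ[ R ])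
    diffSum≈mixedSum R x y = Σsplit-cong R λ {S} {U} sp → *-congˡ (falling-cong (length S) (begin
      y - κ[ S ]                        ≈⟨ solve 3 (λ y s u → y :- s := (y :- (s :+ u)) :+ u) refl y κ[ S ] κ[ U ] ⟩
      (y - (κ[ S ] + κ[ U ])) + κ[ U ]  ≈⟨ +-congʳ (+-congˡ (-‿cong (κ-interleave sp))) ⟨
      (y - κ[ R ]) + κ[ U ]             ∎))

    diffSum-shift : ∀ R x y δ → diffSum R (x + δ) (y - δ) ≈ diffSum R x y
    diffSum-shift R x y δ = begin
      diffSum R (x + δ) (y - δ)              ≈⟨ diffSum≈mixedSum R _ _ ⟩
      mixedSum R (x + δ) ((y - δ) - κ[ R ])  ≈⟨ mixedSum-transfer R x _ δ ⟩
      mixedSum R x (((y - δ) - κ[ R ]) + δ)  ≈⟨ mixedSum-cong R refl (solve 3 (λ y δ k → ((y :- δ) :- k) :+ δ := y :- k) refl y δ κ[ R ]) ⟩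
      mixedSum R x (y - κ[ R ])              ≈⟨ diffSum≈mixedSum R x y ⟨
      diffSum R x y                          ∎

    abelTerm : Carrier → Carrier → ℕ → ℕ → ℕ → ℕ → Carrier
    abelTerm a b zero    m u w = 0#
    abelTerm a b (suc l) m u w = falling (a + κ (suc l) m) u * falling ((b - 1#) - κ (suc l) m) l

    abelSum : List ℕ → Carrier → Carrier → Carrier
    abelSum ps a b = Σsub ps (abelTerm a b)

    diffTerm : Carrier → Carrier → ℕ → ℕ → ℕ → ℕ → Carrier
    diffTerm a b zero    m u w = 0#
    diffTerm a b (suc l) m u w = falling (a + κ (suc l) m) u * falling ((b - 1#) - κ (suc l) m) (suc l)

    diffSum-pred : ∀ ps a b → diffSum ps a (b - 1#) ≈ Σsub ps (diffTerm a b) + falling a (length ps)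
    diffSum-pred ps a b = trans (Σsplit-cong ps split) (trans (Σsplit-+ ps _ _) (+-congˡ (Σsplit-whenEmpty ps _)))
      where
      split : ∀ {S U} → Interleaving S U ps →
        falling (a + κ[ S ]) (length U) * falling ((b - 1#) - κ[ S ]) (length S)
          ≈ diffTerm a b (length S) (sum S) (length U) (sum U) + whenEmpty S (falling a (length ps))
      split {[]} {U} sp rewrite interleave-length sp =
        trans (*-cong (falling-cong (length U) (x+κ-zero a)) refl) (trans (*-identityʳ _) (sym (+-identityˡ _)))
      split {_ ∷ _} sp = sym (+-identityʳ _)

    abelSum-∷-chosen : ∀ p ps a b →
      Σsub ps (λ l m u w → abelTerm a b (suc l) (p ℕ.+ m) u w) ≈ Σsub ps (diffTerm a b) + falling a (length ps)
    abelSum-∷-chosen p ps a b = begin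
      Σsub ps (λ l m u w → abelTerm a b (suc l) (p ℕ.+ m) u w)
        ≈⟨ Σsplit-cong ps (λ {S} {U} _ → *-cong
             (falling-cong (length U) (trans (+-congˡ (κ-+ 1 (length S) p (sum S))) (sym (+-assoc _ _ _))))
             (falling-cong (length S) (trans (+-congˡ (-‿cong (κ-+ 1 (length S) p (sum S))))
               (solve 3 (λ y c k → y :- (c :+ k) := (y :- c) :- k) refl _ _ _)))) ⟩
      diffSum ps (a + κ 1 p) ((b - 1#) - κ 1 p)             ≈⟨ diffSum-shift ps a (b - 1#) (κ 1 p) ⟩
      diffSum ps a (b - 1#)                                 ≈⟨ diffSum-pred ps a b ⟩
      Σsub ps (diffTerm a b) + falling a (length ps)        ∎

    abelSum-∷-unchosen : ∀ p ps a b →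
      Σsub ps (λ l m u w → abelTerm a b l m (suc u) (p ℕ.+ w))
        ≈ (a + b - fromℕ (length ps)) * abelSum ps a b - Σsub ps (diffTerm a b)
    abelSum-∷-unchosen p ps a b =
      trans (Σsplit-cong ps split) (trans (Σsplit-+ ps _ _) (+-cong (Σsplit-*ˡ ps _ _) (Σsplit-neg ps _)))
      where
      split : ∀ {S U} → Interleaving S U ps →
        abelTerm a b (length S) (sum S) (suc (length U)) (p ℕ.+ sum U)
          ≈ (a + b - fromℕ (length ps)) * abelTerm a b (length S) (sum S) (length U) (sum U)
            + - diffTerm a b (length S) (sum S) (length U) (sum U)
      split {[]}    _ = sym (trans (+-cong (zeroʳ _) refl) (trans (+-identityˡ _) -0#≈0#))
      split {q ∷ S} {U} sp = begin
        (fx * (a + κ (suc l) m - fromℕ u)) * fy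
          ≈⟨ solve 8 (λ fx fy a b κ l u k → (fx :* ((a :+ κ) :- u)) :* fy :=
               (a :+ b :- ((:1 :+ l) :+ u)) :* (fx :* fy) :+ :- (fx :* (fy :* (((b :- :1) :- κ) :- l))))
               refl fx fy a b (κ (suc l) m) (fromℕ l) (fromℕ u) (fromℕ (length ps)) ⟩
        (a + b - ((1# + fromℕ l) + fromℕ u)) * (fx * fy) + - (fx * (fy * (((b - 1#) - κ (suc l) m) - fromℕ l)))
          ≈⟨ +-congʳ (*-congʳ (+-congˡ (-‿cong (sym |ps|≈)))) ⟩
        (a + b - fromℕ (length ps)) * (fx * fy) + - (fx * (fy * (((b - 1#) - κ (suc l) m) - fromℕ l)))
          ∎
        where
        l m u : ℕ
        l = length S
        m = sum (q ∷ S)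
        u = length U
        fx fy : Carrier
        fx = falling (a + κ (suc l) m) u
        fy = falling ((b - 1#) - κ (suc l) m) l
        |ps|≈ : fromℕ (length ps) ≈ (1# + fromℕ l) + fromℕ u
        |ps|≈ = trans (reflexive (≡.cong fromℕ (interleave-length sp))) (fromℕ-+ (suc l) u)

    abel-identity : ∀ ps a b → b * abelSum ps a b + falling a (length ps) ≈ falling (a + b) (length ps)
    abel-identity []       a b = trans (+-congʳ (zeroʳ b)) (+-identityˡ _)
    abel-identity (p ∷ ps) a b = begin
      b * (Σsub ps (λ l m u w → abelTerm a b (suc l) (p ℕ.+ m) u w) + Σsub ps (λ l m u w → abelTerm a b l m (suc u) (p ℕ.+ w)))
        + falling a k * (a - fromℕ k)
        ≈⟨ +-congʳ (*-congˡ (+-cong (abelSum-∷-chosen p ps a b) (abelSum-∷-unchosen p ps a b))) ⟩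
      b * ((D + falling a k) + ((a + b - fromℕ k) * abelSum ps a b - D)) + falling a k * (a - fromℕ k)
        ≈⟨ solve 6 (λ b d f a k g → b :* ((d :+ f) :+ ((a :+ b :- k) :* g :- d)) :+ f :* (a :- k) := (b :* g :+ f) :* ((a :+ b) :- k))
                   refl b D (falling a k) a (fromℕ k) (abelSum ps a b) ⟩
      (b * abelSum ps a b + falling a k) * ((a + b) - fromℕ k)
        ≈⟨ *-congʳ (abel-identity ps a b) ⟩
      falling (a + b) k * ((a + b) - fromℕ k)
        ∎
      where
      k : ℕ
      k = length ps
      D : Carrier
      D = Σsub ps (diffTerm a b)

    abelTerm′ : Carrier → Carrier → ℕ → ℕ → ℕ → ℕ → Carrier
    abelTerm′ a b l m zero    w = 0#
    abelTerm′ a b l m (suc u) w = falling ((a + κ l m) - 1#) u * falling (b - κ l m) l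

    abelSum′≈abelSum : ∀ ps a b → Σsub ps (abelTerm′ a b) ≈ abelSum ps (b - κ[ ps ]) (a + κ[ ps ])
    abelSum′≈abelSum ps a b = sym (trans (Σsplit-swap ps _) (Σsplit-cong ps dual))
      where
      dual : ∀ {S U} → Interleaving S U ps →
        abelTerm (b - κ[ ps ]) (a + κ[ ps ]) (length U) (sum U) (length S) (sum S)
          ≈ abelTerm′ a b (length S) (sum S) (length U) (sum U)
      dual {S} {[]}    _  = refl
      dual {S} {U@(_ ∷ U′)} sp = trans (*-cong (falling-cong (length S) bS) (falling-cong (length U′) aS)) (*-comm _ _)
        where
        bS : (b - κ[ ps ]) + κ[ U ] ≈ b - κ[ S ]
        bS = trans (+-congʳ (+-congˡ (-‿cong (κ-interleave sp))))
                   (solve 3 (λ b s u → (b :- (s :+ u)) :+ u := b :- s) refl b κ[ S ] κ[ U ])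
        aS : ((a + κ[ ps ]) - 1#) - κ[ U ] ≈ (a + κ[ S ]) - 1#
        aS = trans (+-congʳ (+-congʳ (+-congˡ (κ-interleave sp))))
                   (solve 3 (λ a s u → ((a :+ (s :+ u)) :- :1) :- u := (a :+ s) :- :1) refl a κ[ S ] κ[ U ])

    abel-identity′ : ∀ ps a b →
      (a + κ[ ps ]) * Σsub ps (abelTerm′ a b) + falling (b - κ[ ps ]) (length ps) ≈ falling (a + b) (length ps)
    abel-identity′ ps a b = begin
      (a + κ[ ps ]) * Σsub ps (abelTerm′ a b) + falling (b - κ[ ps ]) (length ps)
        ≈⟨ +-congʳ (*-congˡ (abelSum′≈abelSum ps a b)) ⟩
      (a + κ[ ps ]) * abelSum ps (b - κ[ ps ]) (a + κ[ ps ]) + falling (b - κ[ ps ]) (length ps)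
        ≈⟨ abel-identity ps _ _ ⟩
      falling ((b - κ[ ps ]) + (a + κ[ ps ])) (length ps)
        ≈⟨ falling-cong (length ps) (solve 3 (λ a b k → (b :- k) :+ (a :+ k) := a :+ b) refl a b κ[ ps ]) ⟩
      falling (a + b) (length ps)
        ∎

    module Summation (ps : List ℕ) (ps>0 : All (0 ℕ.<_) ps) (a τ : Carrier) (α : ℕ → ℕ → Carrier)
                     (α≈ : ∀ l m → α l m ≈ a + κ l m)
                     (α≉0 : ∀ l m → l ℕ.≤ length ps → l ℕ.≤ m → m ℕ.≤ sum ps → α l m ≉ 0# × τ - α l m ≉ 0#)
                     where
      k n : ℕ
      k = length ps
      n = sum ps

      α≉0-split : ∀ {S U} → Interleaving S U ps → α (length S) (sum S) ≉ 0# × τ - α (length S) (sum S) ≉ 0#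
      α≉0-split {S} {U} sp = α≉0 (length S) (sum S)
        (ℕ.≤-trans (ℕ.m≤m+n (length S) (length U)) (ℕ.≤-reflexive (≡.sym (interleave-length sp))))
        (length≤sum (All-interleaveˡ ps>0 sp))
        (ℕ.≤-trans (ℕ.m≤m+n (sum S) (sum U)) (ℕ.≤-reflexive (≡.sym (sum-interleave sp))))

      k∸|S|≡|U| : ∀ {S U} → Interleaving S U ps → k ∸ length S ≡ length U
      k∸|S|≡|U| {S} {U} sp = ≡.trans (≡.cong (_∸ length S) (interleave-length sp)) (ℕ.m+n∸m≡n (length S) (length U))

      αkn≉0 : α k n ≉ 0#
      αkn≉0 = proj₁ (α≉0 k n ℕ.≤-refl (length≤sum ps>0) ℕ.≤-refl)

      τ-α00≉0 : τ - α 0 0 ≉ 0#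
      τ-α00≉0 = proj₂ (α≉0 0 0 z≤n z≤n z≤n)

      ⅟α ⅟τ-α : ℕ → ℕ → Carrier
      ⅟α   l m = falling (α l m) (k ∸ l) * falling (τ - α l m) l * α l m ⁻¹
      ⅟τ-α l m = falling (α l m) (k ∸ l) * falling (τ - α l m) l * (τ - α l m) ⁻¹

      ⅟α-split : ∀ {S U} → Interleaving S U ps → ⅟α (length S) (sum S) ≈
        abelTerm′ a (τ - a) (length S) (sum S) (length U) (sum U) + whenEmpty U (falling (τ - α k n) k * α k n ⁻¹)
      ⅟α-split {S} {[]} sp = trans (whole (≡.trans (≡.sym (ℕ.+-identityʳ _)) (≡.sym (interleave-length sp)))
                                          (≡.trans (≡.sym (ℕ.+-identityʳ _)) (≡.sym (sum-interleave sp))))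
                                   (sym (+-identityˡ _))
        where
        whole : ∀ {l m} → l ≡ k → m ≡ n → ⅟α l m ≈ falling (τ - α k n) k * α k n ⁻¹
        whole ≡.refl ≡.refl = trans (*-congʳ (*-congʳ (reflexive (≡.cong (falling _) (ℕ.n∸n≡0 k))))) (*-congʳ (*-identityˡ _))
      ⅟α-split {S} {U@(_ ∷ U′)} sp = begin
        falling x (k ∸ length S) * falling (τ - x) (length S) * x ⁻¹
          ≈⟨ *-congʳ (*-congʳ (trans (reflexive (≡.cong (falling x) (k∸|S|≡|U| sp))) (falling-sucˡ x (length U′)))) ⟩
        (x * falling (x - 1#) (length U′)) * falling (τ - x) (length S) * x ⁻¹
          ≈⟨ *-congʳ (solve 3 (λ x f g → (x :* f) :* g := (f :* g) :* x) refl x _ _) ⟩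
        ((falling (x - 1#) (length U′) * falling (τ - x) (length S)) * x) * x ⁻¹
          ≈⟨ *⁻¹-cancelʳ _ (proj₁ (α≉0-split sp)) ⟩
        falling (x - 1#) (length U′) * falling (τ - x) (length S)
          ≈⟨ *-cong (falling-cong (length U′) (+-congʳ (α≈ _ _))) (falling-cong (length S) (trans (+-congˡ (-‿cong (α≈ _ _)))
               (solve 3 (λ τ a κ → τ :- (a :+ κ) := (τ :- a) :- κ) refl τ a κ[ S ]))) ⟩
        abelTerm′ a (τ - a) (length S) (sum S) (length U) (sum U)
          ≈⟨ +-identityʳ _ ⟨
        abelTerm′ a (τ - a) (length S) (sum S) (length U) (sum U) + 0#
          ∎
        where
        x : Carrier
        x = α (length S) (sum S)

      ⅟τ-α-split : ∀ {S U} → Interleaving S U ps → ⅟τ-α (length S) (sum S) ≈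
        abelTerm a (τ - a) (length S) (sum S) (length U) (sum U) + whenEmpty S (falling (α 0 0) k * (τ - α 0 0) ⁻¹)
      ⅟τ-α-split {[]}         _  = trans (*-congʳ (*-identityʳ _)) (sym (+-identityˡ _))
      ⅟τ-α-split {S@(_ ∷ S′)} {U} sp = begin
        falling x (k ∸ length S) * falling y (length S) * y ⁻¹
          ≈⟨ *-congʳ (*-cong (reflexive (≡.cong (falling x) (k∸|S|≡|U| sp))) (falling-sucˡ y (length S′))) ⟩
        falling x (length U) * (y * falling (y - 1#) (length S′)) * y ⁻¹
          ≈⟨ *-congʳ (solve 3 (λ f y g → f :* (y :* g) := (f :* g) :* y) refl _ y _) ⟩
        ((falling x (length U) * falling (y - 1#) (length S′)) * y) * y ⁻¹
          ≈⟨ *⁻¹-cancelʳ _ (proj₂ (α≉0-split sp)) ⟩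
        falling x (length U) * falling (y - 1#) (length S′)
          ≈⟨ *-cong (falling-cong (length U) (α≈ _ _)) (falling-cong (length S′) (trans (+-congʳ (+-congˡ (-‿cong (α≈ _ _))))
               (solve 3 (λ τ a κ → (τ :- (a :+ κ)) :- :1 := ((τ :- a) :- :1) :- κ) refl τ a κ[ S ]))) ⟩
        abelTerm a (τ - a) (length S) (sum S) (length U) (sum U)
          ≈⟨ +-identityʳ _ ⟨
        abelTerm a (τ - a) (length S) (sum S) (length U) (sum U) + 0#
          ∎
        where
        x y : Carrier
        x = α (length S) (sum S)
        y = τ - x

      Σ⅟α : Σsub ps (λ l m _ _ → ⅟α l m) ≈ falling τ k * α k n ⁻¹
      Σ⅟α = begin
        Σsub ps (λ l m _ _ → ⅟α l m)
          ≈⟨ trans (Σsplit-cong ps ⅟α-split) (Σsplit-+ ps _ _) ⟩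
        Σsub ps (abelTerm′ a (τ - a)) + Σsplit ps (λ S U → whenEmpty U (falling (τ - α k n) k * α k n ⁻¹))
          ≈⟨ +-congˡ (Σsplit-whenEmptyʳ ps _) ⟩
        Σsub ps (abelTerm′ a (τ - a)) + falling (τ - α k n) k * α k n ⁻¹
          ≈⟨ +-congʳ (*⁻¹-cancelʳ _ αkn≉0) ⟨
        (Σsub ps (abelTerm′ a (τ - a)) * α k n) * α k n ⁻¹ + falling (τ - α k n) k * α k n ⁻¹
          ≈⟨ trans (sym (distribʳ _ _ _)) (*-congʳ (+-congʳ (*-comm _ _))) ⟩
        (α k n * Σsub ps (abelTerm′ a (τ - a)) + falling (τ - α k n) k) * α k n ⁻¹
          ≈⟨ *-congʳ (+-cong (*-congʳ (α≈ k n)) (falling-cong k (trans (+-congˡ (-‿cong (α≈ k n)))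
               (solve 3 (λ τ a κ → τ :- (a :+ κ) := (τ :- a) :- κ) refl τ a κ[ ps ])))) ⟩
        ((a + κ[ ps ]) * Σsub ps (abelTerm′ a (τ - a)) + falling ((τ - a) - κ[ ps ]) k) * α k n ⁻¹
          ≈⟨ *-congʳ (abel-identity′ ps a (τ - a)) ⟩
        falling (a + (τ - a)) k * α k n ⁻¹
          ≈⟨ *-congʳ (falling-cong k (solve 2 (λ a τ → a :+ (τ :- a) := τ) refl a τ)) ⟩
        falling τ k * α k n ⁻¹
          ∎

      Σ⅟τ-α : Σsub ps (λ l m _ _ → ⅟τ-α l m) ≈ falling τ k * (τ - α 0 0) ⁻¹
      Σ⅟τ-α = begin
        Σsub ps (λ l m _ _ → ⅟τ-α l m)
          ≈⟨ trans (Σsplit-cong ps ⅟τ-α-split) (Σsplit-+ ps _ _) ⟩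
        abelSum ps a (τ - a) + Σsplit ps (λ S U → whenEmpty S (falling (α 0 0) k * (τ - α 0 0) ⁻¹))
          ≈⟨ +-congˡ (Σsplit-whenEmpty ps _) ⟩
        abelSum ps a (τ - a) + falling (α 0 0) k * (τ - α 0 0) ⁻¹
          ≈⟨ +-congʳ (*⁻¹-cancelʳ _ τ-α00≉0) ⟨
        (abelSum ps a (τ - a) * (τ - α 0 0)) * (τ - α 0 0) ⁻¹ + falling (α 0 0) k * (τ - α 0 0) ⁻¹
          ≈⟨ trans (sym (distribʳ _ _ _)) (*-congʳ (+-congʳ (*-comm _ _))) ⟩
        ((τ - α 0 0) * abelSum ps a (τ - a) + falling (α 0 0) k) * (τ - α 0 0) ⁻¹
          ≈⟨ *-congʳ (+-cong (*-congʳ (+-congˡ (-‿cong α00≈a))) (falling-cong k α00≈a)) ⟩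
        ((τ - a) * abelSum ps a (τ - a) + falling a k) * (τ - α 0 0) ⁻¹
          ≈⟨ *-congʳ (abel-identity ps a (τ - a)) ⟩
        falling (a + (τ - a)) k * (τ - α 0 0) ⁻¹
          ≈⟨ *-congʳ (falling-cong k (solve 2 (λ a τ → a :+ (τ :- a) := τ) refl a τ)) ⟩
        falling τ k * (τ - α 0 0) ⁻¹
          ∎
        where
        α00≈a : α 0 0 ≈ a
        α00≈a = trans (α≈ 0 0) (x+κ-zero a)

      Σsub-summand : Σsub ps (λ l m _ _ → summand τ (α l m) k l) ≈
                     ((τ - α 0 0 + α k n) ÷ (α k n * (τ - α 0 0))) * binom τ k
      Σsub-summand = begin
        Σsub ps (λ l m _ _ → summand τ (α l m) k l)
          ≈⟨ Σsplit-cong ps (λ {S} {U} sp → summand-partialFractions τ _ k (length S)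
               (ℕ.≤-trans (ℕ.m≤m+n (length S) (length U)) (ℕ.≤-reflexive (≡.sym (interleave-length sp))))
               (proj₁ (α≉0-split sp)) (proj₂ (α≉0-split sp))) ⟩
        Σsub ps (λ l m _ _ → fromℕ (factorial k) ⁻¹ * (⅟α l m + ⅟τ-α l m))
          ≈⟨ trans (Σsplit-*ˡ ps _ _) (*-congˡ (Σsplit-+ ps _ _)) ⟩
        fromℕ (factorial k) ⁻¹ * (Σsub ps (λ l m _ _ → ⅟α l m) + Σsub ps (λ l m _ _ → ⅟τ-α l m))
          ≈⟨ *-congˡ (+-cong Σ⅟α Σ⅟τ-α) ⟩
        fromℕ (factorial k) ⁻¹ * (falling τ k * α k n ⁻¹ + falling τ k * (τ - α 0 0) ⁻¹)
          ≈⟨ solve 4 (λ i f a b → i :* (f :* a :+ f :* b) := (a :+ b) :* (f :* i)) refl _ _ _ _ ⟩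
        (α k n ⁻¹ + (τ - α 0 0) ⁻¹) * binom τ k
          ≈⟨ *-congʳ (⁻¹+⁻¹ αkn≉0 τ-α00≉0) ⟩
        ((τ - α 0 0 + α k n) ÷ (α k n * (τ - α 0 0))) * binom τ k
          ∎

  -- From the W-weighted double sum to splittings of the parts of v

  ΣL : ∀ {A : Set} → List A → (A → Carrier) → Carrier
  ΣL xs f = foldr (λ x acc → f x + acc) 0# xs

  ΣL-cong : ∀ {A : Set} (xs : List A) {f g : A → Carrier} → (∀ x → f x ≈ g x) → ΣL xs f ≈ ΣL xs g
  ΣL-cong []       f≈g = refl
  ΣL-cong (x ∷ xs) f≈g = +-cong (f≈g x) (ΣL-cong xs f≈g)

  ΣL-0 : ∀ {A : Set} (xs : List A) {f : A → Carrier} → (∀ x → f x ≈ 0#) → ΣL xs f ≈ 0#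
  ΣL-0 []       f≈0 = refl
  ΣL-0 (x ∷ xs) f≈0 = trans (+-cong (f≈0 x) (ΣL-0 xs f≈0)) (+-identityʳ _)

  ΣL-++ : ∀ {A : Set} (xs ys : List A) f → ΣL (xs ++ ys) f ≈ ΣL xs f + ΣL ys f
  ΣL-++ []       ys f = sym (+-identityˡ _)
  ΣL-++ (x ∷ xs) ys f = trans (+-congˡ (ΣL-++ xs ys f)) (sym (+-assoc _ _ _))

  ΣL-concatMap : ∀ {A B : Set} (g : A → List B) (xs : List A) f → ΣL (concatMap g xs) f ≈ ΣL xs (λ x → ΣL (g x) f)
  ΣL-concatMap g []       f = refl
  ΣL-concatMap g (x ∷ xs) f = trans (ΣL-++ (g x) _ f) (+-congˡ (ΣL-concatMap g xs f))

  ΣL-map : ∀ {A B : Set} (g : A → B) (xs : List A) f → ΣL (List.map g xs) f ≈ ΣL xs (λ x → f (g x))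
  ΣL-map g []       f = refl
  ΣL-map g (x ∷ xs) f = +-congˡ (ΣL-map g xs f)

  ΣL-filter : ∀ {A : Set} {P : A → Set} (P? : Decidable P) (xs : List A) f →
              ΣL (filter P? xs) f ≈ ΣL xs (λ x → if does (P? x) then f x else 0#)
  ΣL-filter P? []       f = refl
  ΣL-filter P? (x ∷ xs) f with does (P? x)
  ... | true  = +-congˡ (ΣL-filter P? xs f)
  ... | false = trans (ΣL-filter P? xs f) (sym (+-identityˡ _))

  fromℕ-sumℕ : ∀ {A : Set} (g : A → ℕ) (xs : List A) → fromℕ (sumℕ (List.map g xs)) ≈ ΣL xs (λ x → fromℕ (g x))
  fromℕ-sumℕ g []       = refl
  fromℕ-sumℕ g (x ∷ xs) = trans (fromℕ-+ (g x) _) (+-congˡ (fromℕ-sumℕ g xs))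

  ΣL-applyUpTo-0 : ∀ (g : ℕ → ℕ) n {f : ℕ → Carrier} → (∀ x → f (g x) ≈ 0#) → ΣL (applyUpTo g n) f ≈ 0#
  ΣL-applyUpTo-0 g zero    f≈0 = refl
  ΣL-applyUpTo-0 g (suc n) f≈0 = trans (+-cong (f≈0 0) (ΣL-applyUpTo-0 (g ∘ suc) n (f≈0 ∘ suc))) (+-identityʳ _)

  ΣL-applyUpTo-single : ∀ (g : ℕ → ℕ) n e (f : ℕ → Carrier) → e ℕ.< n →
                        (∀ x → x ≢ e → f (g x) ≈ 0#) → ΣL (applyUpTo g n) f ≈ f (g e)
  ΣL-applyUpTo-single g (suc n) zero    f _ f≈0 =
    trans (+-congˡ (ΣL-applyUpTo-0 (g ∘ suc) n (λ x → f≈0 (suc x) λ ()))) (+-identityʳ _)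
  ΣL-applyUpTo-single g (suc n) (suc e) f (s≤s e<n) f≈0 =
    trans (+-cong (f≈0 0 λ ()) (ΣL-applyUpTo-single (g ∘ suc) n e f e<n (λ x x≢e → f≈0 (suc x) (x≢e ∘ ℕ.suc-injective))))
          (+-identityˡ _)

  ∑-range-single : ∀ a b c (f : ℕ → Carrier) → a ℕ.≤ c → c ℕ.≤ b → (∀ x → x ≢ c → f x ≈ 0#) → ∑ (range a b) f ≈ f c
  ∑-range-single a b c f a≤c c≤b f≈0 = begin
    ∑ (range a b) f       ≈⟨ ΣL-applyUpTo-single (a ℕ.+_) (suc b ∸ a) (c ∸ a) f c∸a<1+b∸a
                               (λ x x≢c∸a → f≈0 (a ℕ.+ x) (λ a+x≡c → x≢c∸a (≡.trans (≡.sym (ℕ.m+n∸m≡n a x)) (≡.cong (_∸ a) a+x≡c)))) ⟩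
    f (a ℕ.+ (c ∸ a))     ≡⟨ ≡.cong f (ℕ.m+[n∸m]≡n a≤c) ⟩
    f c                   ∎
    where
    c∸a<1+b∸a : c ∸ a ℕ.< suc b ∸ a
    c∸a<1+b∸a = ℕ.≤-trans (s≤s (ℕ.∸-monoˡ-≤ a c≤b)) (ℕ.≤-reflexive (≡.sym (ℕ.+-∸-assoc 1 (ℕ.≤-trans a≤c c≤b))))

  Σ≤ : ℕ → (ℕ → Carrier) → Carrier
  Σ≤ zero    f = f 0
  Σ≤ (suc x) f = f 0 + Σ≤ x (f ∘ suc)

  Σ≤-cong : ∀ x {f g : ℕ → Carrier} → (∀ i → f i ≈ g i) → Σ≤ x f ≈ Σ≤ x g
  Σ≤-cong zero    f≈g = f≈g 0
  Σ≤-cong (suc x) f≈g = +-cong (f≈g 0) (Σ≤-cong x (f≈g ∘ suc))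

  Σ≤-+ : ∀ x (f g : ℕ → Carrier) → Σ≤ x (λ i → f i + g i) ≈ Σ≤ x f + Σ≤ x g
  Σ≤-+ zero    f g = refl
  Σ≤-+ (suc x) f g = trans (+-congˡ (Σ≤-+ x _ _)) (solve 4 (λ a b c d → (a :+ b) :+ (c :+ d) := (a :+ c) :+ (b :+ d)) refl _ _ _ _)

  Σ≤-*ˡ : ∀ x y (f : ℕ → Carrier) → Σ≤ x (λ i → y * f i) ≈ y * Σ≤ x f
  Σ≤-*ˡ zero    y f = refl
  Σ≤-*ˡ (suc x) y f = trans (+-congˡ (Σ≤-*ˡ x y _)) (sym (distribˡ _ _ _))

  Σ≤-0 : ∀ x {f : ℕ → Carrier} → (∀ i → f i ≈ 0#) → Σ≤ x f ≈ 0#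
  Σ≤-0 zero    f≈0 = f≈0 0
  Σ≤-0 (suc x) f≈0 = trans (+-cong (f≈0 0) (Σ≤-0 x (f≈0 ∘ suc))) (+-identityʳ _)

  Σ≤-suc : ∀ x (f : ℕ → Carrier) → Σ≤ (suc x) f ≈ Σ≤ x f + f (suc x)
  Σ≤-suc zero    f = refl
  Σ≤-suc (suc x) f = trans (+-congˡ (Σ≤-suc x _)) (sym (+-assoc _ _ _))

  Σ≤-extend : ∀ x y (f : ℕ → Carrier) → x ℕ.≤ y → (∀ i → x ℕ.< i → f i ≈ 0#) → Σ≤ y f ≈ Σ≤ x f
  Σ≤-extend zero    zero    f _         _   = refl
  Σ≤-extend zero    (suc y) f _         f≈0 = trans (+-congˡ (Σ≤-0 y (λ i → f≈0 (suc i) (s≤s z≤n)))) (+-identityʳ _)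
  Σ≤-extend (suc x) (suc y) f (s≤s x≤y) f≈0 = +-congˡ (Σ≤-extend x y (f ∘ suc) x≤y (λ i x<i → f≈0 (suc i) (s≤s x<i)))

  Σ≤-truncate : ∀ x y (f : ℕ → Carrier) → (∀ i → x ℕ.< i → f i ≈ 0#) → (∀ i → y ℕ.< i → f i ≈ 0#) → Σ≤ x f ≈ Σ≤ y f
  Σ≤-truncate x y f fx fy with ℕ.≤-total x y
  ... | inj₁ x≤y = sym (Σ≤-extend x y f x≤y fx)
  ... | inj₂ y≤x = Σ≤-extend y x f y≤x fy

  ΣL-upTo : ∀ (g : ℕ → ℕ) x f → ΣL (applyUpTo g (suc x)) f ≈ Σ≤ x (f ∘ g)
  ΣL-upTo g zero    f = +-identityʳ _
  ΣL-upTo g (suc x) f = +-congˡ (ΣL-upTo (g ∘ suc) x f)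

  Σsub-++ : ∀ xs ys (f : ℕ → ℕ → Carrier) →
    Σsub (xs ++ ys) (λ l m _ _ → f l m) ≈ Σsub xs (λ l m _ _ → Σsub ys (λ l′ m′ _ _ → f (l ℕ.+ l′) (m ℕ.+ m′)))
  Σsub-++ []       ys f = refl
  Σsub-++ (p ∷ xs) ys f = +-cong
    (trans (Σsub-++ xs ys (λ l m → f (suc l) (p ℕ.+ m))) (Σsplit-cong xs λ {S} _ → Σsplit-cong ys λ {S′} _ →
      reflexive (≡.cong (f (suc (length S ℕ.+ length S′))) (≡.sym (ℕ.+-assoc p (sum S) (sum S′))))))
    (Σsub-++ xs ys f)

  Σsub-replicate : ∀ x j (f : ℕ → ℕ → Carrier) →
    Σsub (replicate x j) (λ l m _ _ → f l m) ≈ Σ≤ x (λ i → fromℕ (x C i) * f i (j ℕ.* i))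
  Σsub-replicate zero    j f = trans (sym (*-identityˡ _)) (*-cong (sym (+-identityʳ 1#)) (reflexive (≡.cong (f 0) (≡.sym (ℕ.*-zeroʳ j)))))
  Σsub-replicate (suc x) j f = begin
    Σsub (replicate x j) (λ l m _ _ → f (suc l) (j ℕ.+ m)) + Σsub (replicate x j) (λ l m _ _ → f l m)
      ≈⟨ +-cong (Σsub-replicate x j (λ l m → f (suc l) (j ℕ.+ m))) (Σsub-replicate x j f) ⟩
    Σ≤ x (λ i → fromℕ (x C i) * g i) + Σ≤ x (λ i → fromℕ (x C i) * f i (j ℕ.* i))
      ≈⟨ +-congˡ (trans (sym (+-identityʳ _)) (trans (+-congˡ (sym top≈0)) (sym (Σ≤-suc x _)))) ⟩
    Σ≤ x (λ i → fromℕ (x C i) * g i) + (fromℕ (x C 0) * f 0 (j ℕ.* 0) + Σ≤ x (λ i → fromℕ (x C suc i) * f (suc i) (j ℕ.* suc i)))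
      ≈⟨ solve 3 (λ a b c → a :+ (b :+ c) := b :+ (a :+ c)) refl _ _ _ ⟩
    fromℕ (x C 0) * f 0 (j ℕ.* 0) + (Σ≤ x (λ i → fromℕ (x C i) * g i) + Σ≤ x (λ i → fromℕ (x C suc i) * f (suc i) (j ℕ.* suc i)))
      ≈⟨ +-congˡ (trans (sym (Σ≤-+ x _ _)) (Σ≤-cong x pascal)) ⟩
    fromℕ (suc x C 0) * f 0 (j ℕ.* 0) + Σ≤ x (λ i → fromℕ (suc x C suc i) * f (suc i) (j ℕ.* suc i))
      ∎
    where
    g : ℕ → Carrier
    g i = f (suc i) (j ℕ.+ j ℕ.* i)
    top≈0 : fromℕ (x C suc x) * f (suc x) (j ℕ.* suc x) ≈ 0#
    top≈0 = trans (*-congʳ (reflexive (≡.cong fromℕ (k>n⇒nCk≡0 (ℕ.n<1+n x))))) (zeroˡ _)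
    pascal : ∀ i → fromℕ (x C i) * g i + fromℕ (x C suc i) * f (suc i) (j ℕ.* suc i) ≈ fromℕ (suc x C suc i) * f (suc i) (j ℕ.* suc i)
    pascal i = begin
      fromℕ (x C i) * g i + fromℕ (x C suc i) * f (suc i) (j ℕ.* suc i)
        ≈⟨ +-congʳ (*-congˡ (reflexive (≡.cong (f (suc i)) (≡.sym (ℕ.*-suc j i))))) ⟩
      fromℕ (x C i) * f (suc i) (j ℕ.* suc i) + fromℕ (x C suc i) * f (suc i) (j ℕ.* suc i)
        ≈⟨ distribʳ _ _ _ ⟨
      (fromℕ (x C i) + fromℕ (x C suc i)) * f (suc i) (j ℕ.* suc i)
        ≈⟨ *-congʳ (trans (sym (fromℕ-+ (x C i) (x C suc i))) (reflexive (≡.cong fromℕ (nCk+nC[k+1]≡[n+1]C[k+1] x i)))) ⟩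
      fromℕ (suc x C suc i) * f (suc i) (j ℕ.* suc i)
        ∎

  Σbox : ∀ {d} → Vec ℕ d → (Vec ℕ d → Carrier) → Carrier
  Σbox []       f = f []
  Σbox (x ∷ xs) f = Σ≤ x (λ i → Σbox xs (λ is → f (i ∷ is)))

  Σbox-cong : ∀ {d} (v : Vec ℕ d) {f g : Vec ℕ d → Carrier} → (∀ i → f i ≈ g i) → Σbox v f ≈ Σbox v g
  Σbox-cong []      f≈g = f≈g []
  Σbox-cong (x ∷ v) f≈g = Σ≤-cong x (λ i → Σbox-cong v (λ is → f≈g (i ∷ is)))

  Σbox-*ˡ : ∀ {d} (v : Vec ℕ d) y (f : Vec ℕ d → Carrier) → Σbox v (λ i → y * f i) ≈ y * Σbox v f
  Σbox-*ˡ []      y f = refl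
  Σbox-*ˡ (x ∷ v) y f = trans (Σ≤-cong x (λ i → Σbox-*ˡ v y _)) (Σ≤-*ˡ x y _)

  Σbox-+ : ∀ {d} (v : Vec ℕ d) (f g : Vec ℕ d → Carrier) → Σbox v (λ i → f i + g i) ≈ Σbox v f + Σbox v g
  Σbox-+ []      f g = refl
  Σbox-+ (x ∷ v) f g = trans (Σ≤-cong x (λ i → Σbox-+ v _ _)) (Σ≤-+ x _ _)

  Σbox-0 : ∀ {d} (v : Vec ℕ d) {f : Vec ℕ d → Carrier} → (∀ i → f i ≈ 0#) → Σbox v f ≈ 0#
  Σbox-0 []      f≈0 = f≈0 []
  Σbox-0 (x ∷ v) f≈0 = Σ≤-0 x (λ i → Σbox-0 v (λ is → f≈0 (i ∷ is)))

  ΣL-vecsUpTo : ∀ d b (f : Vec ℕ d → Carrier) → ΣL (vecsUpTo d b) f ≈ Σbox (Vec.replicate d b) f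
  ΣL-vecsUpTo zero    b f = +-identityʳ _
  ΣL-vecsUpTo (suc d) b f = begin
    ΣL (concatMap (λ i → List.map (i ∷_) (vecsUpTo d b)) (applyUpTo id (suc b))) f
      ≈⟨ ΣL-concatMap (λ i → List.map (i ∷_) (vecsUpTo d b)) (applyUpTo id (suc b)) f ⟩
    ΣL (applyUpTo id (suc b)) (λ i → ΣL (List.map (i ∷_) (vecsUpTo d b)) f)
      ≈⟨ ΣL-upTo id b _ ⟩
    Σ≤ b (λ i → ΣL (List.map (i ∷_) (vecsUpTo d b)) f)
      ≈⟨ Σ≤-cong b (λ i → trans (ΣL-map (i ∷_) (vecsUpTo d b) f) (ΣL-vecsUpTo d b _)) ⟩
    Σ≤ b (λ i → Σbox (Vec.replicate d b) (λ is → f (i ∷ is)))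
      ∎

  Σbox-truncate : ∀ {d} (u v : Vec ℕ d) (f : Vec ℕ d → Carrier) →
    (∀ i → ¬ Pointwise ℕ._≤_ i u → f i ≈ 0#) → (∀ i → ¬ Pointwise ℕ._≤_ i v → f i ≈ 0#) → Σbox u f ≈ Σbox v f
  Σbox-truncate []      []      f fu fv = refl
  Σbox-truncate (x ∷ u) (y ∷ v) f fu fv = trans
    (Σ≤-cong x (λ i → Σbox-truncate u v _ (λ is is≰u → fu (i ∷ is) (is≰u ∘ Pointwise.tail))
                                           (λ is is≰v → fv (i ∷ is) (is≰v ∘ Pointwise.tail))))
    (Σ≤-truncate x y _ (λ i x<i → Σbox-0 v (λ is → fu (i ∷ is) (ℕ.<⇒≱ x<i ∘ Pointwise.head)))
                       (λ i y<i → Σbox-0 v (λ is → fv (i ∷ is) (ℕ.<⇒≱ y<i ∘ Pointwise.head))))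

  Σsub-parts : ∀ {d} j (v : Vec ℕ d) (f : ℕ → ℕ → Carrier) →
    Σsub (parts j v) (λ l m _ _ → f l m) ≈ Σbox v (λ i → fromℕ (binomProd v i) * f (vsum i) (wsum′ j i))
  Σsub-parts j []       f = sym (trans (*-congʳ (+-identityʳ 1#)) (*-identityˡ _))
  Σsub-parts j (x ∷ v) f = begin
    Σsub (replicate x j ++ parts (suc j) v) (λ l m _ _ → f l m)
      ≈⟨ Σsub-++ (replicate x j) _ f ⟩
    Σsub (replicate x j) (λ l m _ _ → Σsub (parts (suc j) v) (λ l′ m′ _ _ → f (l ℕ.+ l′) (m ℕ.+ m′)))
      ≈⟨ Σsub-replicate x j (λ l m → Σsub (parts (suc j) v) (λ l′ m′ _ _ → f (l ℕ.+ l′) (m ℕ.+ m′))) ⟩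
    Σ≤ x (λ i → fromℕ (x C i) * Σsub (parts (suc j) v) (λ l′ m′ _ _ → f (i ℕ.+ l′) (j ℕ.* i ℕ.+ m′)))
      ≈⟨ Σ≤-cong x (λ i → trans (*-congˡ (Σsub-parts (suc j) v (λ l′ m′ → f (i ℕ.+ l′) (j ℕ.* i ℕ.+ m′)))) (trans (sym (Σbox-*ˡ v _ _))
           (Σbox-cong v (λ is → trans (sym (*-assoc _ _ _)) (*-congʳ (sym (fromℕ-* (x C i) _))))))) ⟩
    Σ≤ x (λ i → Σbox v (λ is → fromℕ (binomProd (x ∷ v) (i ∷ is)) * f (vsum (i ∷ is)) (wsum′ j (i ∷ is))))
      ∎

  W-term : ∀ {d} → Vec ℕ d → ℕ → ℕ → Vec ℕ d → Carrier
  W-term v l m i = if does ((vsum i ℕ.≟ l) ×-dec (wsum i ℕ.≟ m)) then fromℕ (binomProd v i) else 0#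

  W-term-≢ : ∀ {d} (v : Vec ℕ d) l m i → ¬ (vsum i ≡ l × wsum i ≡ m) → W-term v l m i ≈ 0#
  W-term-≢ v l m i ≢ rewrite dec-false ((vsum i ℕ.≟ l) ×-dec (wsum i ℕ.≟ m)) ≢ = refl

  W-term-≡ : ∀ {d} (v : Vec ℕ d) i → W-term v (vsum i) (wsum i) i ≈ fromℕ (binomProd v i)
  W-term-≡ v i rewrite dec-true ((vsum i ℕ.≟ vsum i) ×-dec (wsum i ℕ.≟ wsum i)) (≡.refl , ≡.refl) = refl

  W-term-≰ : ∀ {d} (v : Vec ℕ d) l m i → ¬ Pointwise ℕ._≤_ i v → W-term v l m i ≈ 0#
  W-term-≰ v l m i i≰v with does ((vsum i ℕ.≟ l) ×-dec (wsum i ℕ.≟ m))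
  ... | true  = reflexive (≡.cong fromℕ (binomProd-≰ v i i≰v))
  ... | false = refl

  fromℕ-W : ∀ {d} (v : Vec ℕ d) l m → fromℕ (W m l v) ≈ Σbox v (W-term v l m)
  fromℕ-W {d} v l m = begin
    fromℕ (sumℕ (List.map (binomProd v) (π d m l)))   ≈⟨ fromℕ-sumℕ (binomProd v) (π d m l) ⟩
    ΣL (π d m l) (λ i → fromℕ (binomProd v i))       ≈⟨ ΣL-filter (λ i → (vsum i ℕ.≟ l) ×-dec (wsum i ℕ.≟ m)) (vecsUpTo d l) _ ⟩
    ΣL (vecsUpTo d l) (W-term v l m)                 ≈⟨ ΣL-vecsUpTo d l _ ⟩
    Σbox (Vec.replicate d l) (W-term v l m)          ≈⟨ Σbox-truncate _ v _
                                                          (λ i i≰l → W-term-≢ v l m i λ (vsum≡l , _) → ℕ.<-irrefl (≡.sym vsum≡l) (≰replicate⇒<vsum i l i≰l))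
                                                          (λ i i≰v → W-term-≰ v l m i i≰v) ⟩
    Σbox v (W-term v l m)                            ∎

  ΣL-Σbox : ∀ {d} {A : Set} (xs : List A) (v : Vec ℕ d) (f : A → Vec ℕ d → Carrier) →
            ΣL xs (λ x → Σbox v (f x)) ≈ Σbox v (λ i → ΣL xs (λ x → f x i))
  ΣL-Σbox []       v f = sym (Σbox-0 v (λ _ → refl))
  ΣL-Σbox (x ∷ xs) v f = trans (+-congˡ (ΣL-Σbox xs v f)) (sym (Σbox-+ v _ _))

  ∑∑-W-term : ∀ {d} (v : Vec ℕ d) (f : ℕ → ℕ → Carrier) i →
    ∑ (range 0 (vsum v)) (λ l → ∑ (range l (wsum v)) (λ m → f l m * W-term v l m i))
      ≈ fromℕ (binomProd v i) * f (vsum i) (wsum i)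
  ∑∑-W-term v f i with Pointwise.decidable ℕ._≤?_ i v
  ... | no i≰v = begin
    ∑ (range 0 (vsum v)) (λ l → ∑ (range l (wsum v)) (λ m → f l m * W-term v l m i))
      ≈⟨ ΣL-0 (range 0 (vsum v)) (λ l → ΣL-0 (range l (wsum v)) (λ m → trans (*-congˡ (W-term-≰ v l m i i≰v)) (zeroʳ _))) ⟩
    0#
      ≈⟨ trans (*-congʳ (reflexive (≡.cong fromℕ (binomProd-≰ v i i≰v)))) (zeroˡ _) ⟨
    fromℕ (binomProd v i) * f (vsum i) (wsum i)
      ∎
  ... | yes i≤v = begin
    ∑ (range 0 (vsum v)) (λ l → ∑ (range l (wsum v)) (λ m → f l m * W-term v l m i))
      ≈⟨ ∑-range-single 0 (vsum v) (vsum i) _ z≤n (vsum-mono i≤v)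
           (λ l l≢ → ΣL-0 (range l (wsum v)) (λ m → trans (*-congˡ (W-term-≢ v l m i (l≢ ∘ ≡.sym ∘ proj₁))) (zeroʳ _))) ⟩
    ∑ (range (vsum i) (wsum v)) (λ m → f (vsum i) m * W-term v (vsum i) m i)
      ≈⟨ ∑-range-single (vsum i) (wsum v) (wsum i) _ (vsum≤wsum′ 1 (s≤s z≤n) i) (wsum′-mono 1 i≤v)
           (λ m m≢ → trans (*-congˡ (W-term-≢ v (vsum i) m i (m≢ ∘ ≡.sym ∘ proj₂))) (zeroʳ _)) ⟩
    f (vsum i) (wsum i) * W-term v (vsum i) (wsum i) i
      ≈⟨ trans (*-congˡ (W-term-≡ v i)) (*-comm _ _) ⟩
    fromℕ (binomProd v i) * f (vsum i) (wsum i)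
      ∎

  ∑∑W≈Σbox : ∀ {d} (v : Vec ℕ d) (f : ℕ → ℕ → Carrier) →
    ∑ (range 0 (vsum v)) (λ l → ∑ (range l (wsum v)) (λ m → f l m * fromℕ (W m l v)))
      ≈ Σbox v (λ i → fromℕ (binomProd v i) * f (vsum i) (wsum i))
  ∑∑W≈Σbox v f = begin
    ∑ (range 0 k) (λ l → ∑ (range l n) (λ m → f l m * fromℕ (W m l v)))
      ≈⟨ ΣL-cong (range 0 k) (λ l → ΣL-cong (range l n) (λ m → trans (*-congˡ (fromℕ-W v l m)) (sym (Σbox-*ˡ v _ _)))) ⟩
    ∑ (range 0 k) (λ l → ∑ (range l n) (λ m → Σbox v (λ i → f l m * W-term v l m i)))
      ≈⟨ ΣL-cong (range 0 k) (λ l → ΣL-Σbox (range l n) v _) ⟩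
    ∑ (range 0 k) (λ l → Σbox v (λ i → ∑ (range l n) (λ m → f l m * W-term v l m i)))
      ≈⟨ ΣL-Σbox (range 0 k) v _ ⟩
    Σbox v (λ i → ∑ (range 0 k) (λ l → ∑ (range l n) (λ m → f l m * W-term v l m i)))
      ≈⟨ Σbox-cong v (∑∑-W-term v f) ⟩
    Σbox v (λ i → fromℕ (binomProd v i) * f (vsum i) (wsum i))
      ∎
    where
    k n : ℕ
    k = vsum v
    n = wsum v

corollary2p3 : ∀ {c ℓ′ : Level} (F : Char0Field c ℓ′) → let open FieldOps F in
    (d n k : ℕ) (v : Vec ℕ d) → vsum v ≡ k → wsum v ≡ n → 0 < k →
    (a b₁ b₂ τ : Carrier) →
    let α : ℕ → ℕ → Carrier
        α l m = a + b₁ * fromℕ l + b₂ * fromℕ m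
    in (∀ (l m : ℕ) → l ≤ k → l ≤ m → m ≤ n → ¬ (α l m ≈ 0#) × ¬ ((τ - α l m) ≈ 0#)) →
    ∑ (range 0 k) (λ l → ∑ (range l n) (λ m →
        ((τ * binom (α l m) (k ∸ l) * binom (τ - α l m) l)
          ÷ (α l m * (τ - α l m) * fromℕ (k C l)))
        * fromℕ (W m l v)))
      ≈ ((τ - α 0 0 + α k n) ÷ (α k n * (τ - α 0 0))) * binom τ k
corollary2p3 F d .(wsum v) .(vsum v) v ≡.refl ≡.refl _ a b₁ b₂ τ α≉0 = begin
  ∑ (range 0 (vsum v)) (λ l → ∑ (range l (wsum v)) (λ m → summand τ (α l m) (vsum v) l * fromℕ (W m l v)))
    ≈⟨ ∑∑W≈Σbox v (λ l m → summand τ (α l m) (vsum v) l) ⟩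
  Σbox v (λ i → fromℕ (binomProd v i) * summand τ (α (vsum i) (wsum i)) (vsum v) (vsum i))
    ≈⟨ Σsub-parts 1 v (λ l m → summand τ (α l m) (vsum v) l) ⟨
  Σsub ps (λ l m _ _ → summand τ (α l m) (vsum v) l)
    ≈⟨ ≡.subst₂ (λ k n → Σsub ps (λ l m _ _ → summand τ (α l m) k l) ≈ ((τ - α 0 0 + α k n) ÷ (α k n * (τ - α 0 0))) * binom τ k)
                (length-parts 1 v) (sum-parts 1 v)
                (Summation.Σsub-summand ps (parts-positive 1 (s≤s z≤n) v) a τ α (λ _ _ → +-assoc _ _ _) α≉0-parts) ⟩
  ((τ - α 0 0 + α (vsum v) (wsum v)) ÷ (α (vsum v) (wsum v) * (τ - α 0 0))) * binom τ (vsum v)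
    ∎
  where
  open FieldOps F
  open Identity F
  open Abel b₁ b₂
  open Combinatorics
  open import Relation.Binary.Reasoning.Setoid setoid
  open import Data.Nat using (z≤n; s≤s)
  open import Data.List using (List; length)
  open import Data.Nat.ListAction using (sum)

  α : ℕ → ℕ → Carrier
  α l m = a + b₁ * fromℕ l + b₂ * fromℕ m

  ps : List ℕ
  ps = parts 1 v

  α≉0-parts : ∀ l m → l ≤ length ps → l ≤ m → m ≤ sum ps → α l m ≉ 0# × τ - α l m ≉ 0#
  α≉0-parts l m l≤k l≤m m≤n = α≉0 l m (≡.subst (l ≤_) (length-parts 1 v) l≤k) l≤m (≡.subst (m ≤_) (sum-parts 1 v) m≤n)
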